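{- Let $m,n\ge1$. The poset $\mathbb{D}_{m,n}$ is a lattice, and the map sending an $m$-Dyck path to the sequence $(u_1,\dots,u_n)$, where $u_i$ is the number of down steps occurring after the $(mi)$-th up step (i.e. after the $i$-th block of $m$ up steps), is an isomorphism from $\mathbb{D}_{m,n}$ onto the subposet of the Nadeau–Tewari poset $\mathcal P_n$ formed by the nonincreasing integer sequences satisfying $m(n-i+1)\le u_i\le mn$ for all $i$. The poset $\mathbb{D}'_{m,n}$ is a join-semilattice, and the map sending a mirrored $m$-Dyck path to the sequence $(u_1,\dots,u_{mn})$, where $u_i$ is the number of blocks $D^m$ of the descents (each descent of length $jm$ being cut into $j$ blocks) occurring after the $i$-th up step, is an isomorphism from $\mathbb{D}'_{m,n}$ onto the subposet of $\mathcal P_{mn}$ formed by the nonincreasing integer sequences satisfying $n-\frac{i-1}{m}\le u_i\le n$ for all $i$.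
   Context: A Dyck path of size $N$ is a lattice path from $(0,0)$ with $N$ up steps $U=(1,1)$ and $N$ down steps $D=(1,-1)$, ending on the $x$-axis and never going strictly below it. $\mathbb{D}_N$ is the set of Dyck paths of size $N$ ordered by the reflexive-transitive closure of the relation replacing a factor $DU^kD$ ($k\ge1$) by $U^kDD$. $\mathbb{D}_{m,n}$ (resp. $\mathbb{D}'_{m,n}$) is the set of Dyck paths of size $mn$ whose ascent lengths (resp. descent lengths; ascents/descents being maximal runs of up/down steps) are all multiples of $m$, with the order induced from $\mathbb{D}_{mn}$; elements are called $m$-Dyck paths (resp. mirrored $m$-Dyck paths). The Nadeau–Tewari poset $\mathcal P_n$ is the set of nonincreasing integer sequences $(u_1,\dots,u_n)$ with $u\trianglelefteq v$ iff $u_i\le v_i$ for all $i$ and, for every $i$, $v_i>v_{i+1}$ implies $u_i>u_{i+1}$. -}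

module Defs where

open import Data.Nat as ℕ using (ℕ; zero; suc; _*_; NonZero)
open import Data.Nat.Divisibility using (_∣_)
open import Data.Integer as ℤ using (ℤ; +_)
open import Data.Rational as ℚ using (ℚ)
open import Data.Fin using (Fin; toℕ)
open import Data.Vec using (Vec; lookup; tabulate)
open import Data.List using (List; []; _∷_; _++_; replicate; map)
open import Data.Nat.ListAction using (sum)
open import Data.List.Relation.Unary.All using (All)
open import Data.Product using (Σ; ∃; _×_; _,_)
open import Relation.Binary.PropositionalEquality using (_≡_)
open import Relation.Binary.Construct.Closure.ReflexiveTransitive using (Star)
open import Function.Bundles using (_⇔_)

data Step : Set where
  U D : Step

Path : Set
Path = List Step

countD : Path → ℕ
countD [] = 0
countD (U ∷ p) = countD p
countD (D ∷ p) = suc (countD p)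

countU : Path → ℕ
countU [] = 0
countU (U ∷ p) = suc (countU p)
countU (D ∷ p) = countU p

data DyckFrom : ℕ → Path → Set where
  end  : DyckFrom 0 []
  up   : ∀ {h p} → DyckFrom (suc h) p → DyckFrom h (U ∷ p)
  down : ∀ {h p} → DyckFrom h p → DyckFrom (suc h) (D ∷ p)

IsDyck : ℕ → Path → Set
IsDyck N p = DyckFrom 0 p × countU p ≡ N × countD p ≡ N

addStep : Step → List (Step × ℕ) → List (Step × ℕ)
addStep s [] = (s , 1) ∷ []
addStep U ((U , k) ∷ r) = (U , suc k) ∷ r
addStep D ((D , k) ∷ r) = (D , suc k) ∷ r
addStep U ((D , k) ∷ r) = (U , 1) ∷ (D , k) ∷ r
addStep D ((U , k) ∷ r) = (D , 1) ∷ (U , k) ∷ r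

runs : Path → List (Step × ℕ)
runs [] = []
runs (s ∷ p) = addStep s (runs p)

runsOf : Step → List (Step × ℕ) → List ℕ
runsOf s [] = []
runsOf U ((U , k) ∷ r) = k ∷ runsOf U r
runsOf U ((D , k) ∷ r) = runsOf U r
runsOf D ((D , k) ∷ r) = k ∷ runsOf D r
runsOf D ((U , k) ∷ r) = runsOf D r

ascentLengths : Path → List ℕ
ascentLengths p = runsOf U (runs p)

descentLengths : Path → List ℕ
descentLengths p = runsOf D (runs p)

Move : Path → Path → Set
Move p q = Σ Path λ xs → Σ Path λ ys → Σ ℕ λ k → 1 ℕ.≤ k ×
  p ≡ xs ++ (D ∷ replicate k U ++ (D ∷ ys)) ×
  q ≡ xs ++ (replicate k U ++ (D ∷ D ∷ ys))

MoveIn : ℕ → Path → Path → Set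
MoveIn N p q = IsDyck N p × IsDyck N q × Move p q

_≤𝔻[_]_ : Path → ℕ → Path → Set
p ≤𝔻[ N ] q = Star (MoveIn N) p q

IsMDyck : ℕ → ℕ → Path → Set
IsMDyck m n p = IsDyck (m * n) p × All (m ∣_) (ascentLengths p)

IsMirroredMDyck : ℕ → ℕ → Path → Set
IsMirroredMDyck m n p = IsDyck (m * n) p × All (m ∣_) (descentLengths p)

afterUp : ℕ → Path → Path
afterUp zero p = p
afterUp (suc k) [] = []
afterUp (suc k) (U ∷ p) = afterUp k p
afterUp (suc k) (D ∷ p) = afterUp (suc k) p

φ : (m n : ℕ) → Path → Vec ℤ n
φ m n p = tabulate λ (j : Fin n) → + countD (afterUp (m * suc (toℕ j)) p)

blocks : (m : ℕ) → .{{NonZero m}} → Path → ℕ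
blocks m p = sum (map (λ ℓ → ℓ ℕ./ m) (descentLengths p))

ψ : (m n : ℕ) → .{{NonZero m}} → Path → Vec ℤ (m * n)
ψ m n p = tabulate λ (j : Fin (m * n)) → + blocks m (afterUp (suc (toℕ j)) p)

-- The Nadeau–Tewari poset 𝒫_n (integer sequences as Vec ℤ n;
-- index j : Fin n stands for i = toℕ j + 1)

Nonincreasing : ∀ {n} → Vec ℤ n → Set
Nonincreasing {n} u = (i j : Fin n) → toℕ j ≡ suc (toℕ i) →
  lookup u j ℤ.≤ lookup u i

_⊴_ : ∀ {n} → Vec ℤ n → Vec ℤ n → Set
_⊴_ {n} u v = ((i : Fin n) → lookup u i ℤ.≤ lookup v i) ×
  ((i j : Fin n) → toℕ j ≡ suc (toℕ i) →
     lookup v j ℤ.< lookup v i → lookup u j ℤ.< lookup u i)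

InSeqs : (m n : ℕ) → Vec ℤ n → Set
InSeqs m n u = Nonincreasing u × ((j : Fin n) →
  (+ m ℤ.* (+ n ℤ.- + suc (toℕ j) ℤ.+ ℤ.1ℤ) ℤ.≤ lookup u j) ×
  (lookup u j ℤ.≤ + (m * n)))

InSeqs' : (m n : ℕ) → .{{NonZero m}} → Vec ℤ (m * n) → Set
InSeqs' m n u = Nonincreasing u × ((j : Fin (m * n)) →
  ((+ n ℚ./ 1) ℚ.- ((+ suc (toℕ j) ℤ.- ℤ.1ℤ) ℚ./ m) ℚ.≤ (lookup u j ℚ./ 1)) ×
  (lookup u j ℤ.≤ + n))

IsJoin : ∀ {A : Set} → (A → Set) → (A → A → Set) → A → A → A → Set
IsJoin S R x y z = S z × R x z × R y z × (∀ w → S w → R x w → R y w → R z w)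

IsMeet : ∀ {A : Set} → (A → Set) → (A → A → Set) → A → A → A → Set
IsMeet S R x y z = S z × R z x × R z y × (∀ w → S w → R w x → R w y → R w z)

IsJoinSemilattice : ∀ {A : Set} → (A → Set) → (A → A → Set) → Set
IsJoinSemilattice {A} S R = ∀ x y → S x → S y → ∃ λ z → IsJoin S R x y z

IsLattice : ∀ {A : Set} → (A → Set) → (A → A → Set) → Set
IsLattice {A} S R = IsJoinSemilattice S R ×
  (∀ x y → S x → S y → ∃ λ z → IsMeet S R x y z)

IsIsoOnto : ∀ {A B : Set} → (A → Set) → (A → A → Set) →
  (B → Set) → (B → B → Set) → (A → B) → Set
IsIsoOnto {A} {B} S R T Q f =
  (∀ x → S x → T (f x)) ×
  (∀ x y → S x → S y → f x ≡ f y → x ≡ y) ×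
  (∀ u → T u → ∃ λ x → S x × f x ≡ u) ×
  (∀ x y → S x → S y → (R x y ⇔ Q (f x) (f y)))

-- A Dyck path is determined by its down-counts u_i (the number of down steps
-- after the i-th up step), and the paths of size N are exactly those with
-- nonincreasing u and N ≥ u_i ≥ N - i + 1. A move D U^k D → U^k D D raises by
-- one a run of equal entries of u that its predecessor strictly exceeds, so
-- moves increase u in the Nadeau–Tewari order ≼; conversely, if u ≼ v and
-- u ≠ v, the first entry where they differ can be raised by such a move
-- without leaving the interval below v. For m-Dyck paths u repeats each value
-- in blocks of m, for mirrored ones all its values are multiples of m;
-- collapsing the blocks, resp. dividing by m, gives the sequences of the
-- statement, and the orders correspond. Joins of such sequences, and meets
-- under the staircase bound u_i ≥ m(n - i + 1), are built entry by entry,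
-- descending only where both arguments do, resp. wherever one of them does.
module Submission where

open import Defs
open import Data.Nat using (ℕ; _*_; _≤_; NonZero)
open import Data.Product using (_×_)

open import Data.Nat as ℕ using (zero; suc; _+_; _∸_; _<_; _≟_; _<?_; _⊔_; _⊓_; _/_; z≤n; s≤s; s≤s⁻¹; z<s)
open import Data.Nat.Properties
open import Data.Nat.Divisibility using (_∣_; _∣0; ∣-refl; ∣⇒≤; >⇒∤; ∣m+n∣m⇒∣n; ∣m∣n⇒∣m+n; m∣m*n)
open import Data.Nat.DivMod using (0/n≡0; +-distrib-/-∣ˡ; m*[n/m]≡n; m*n/n≡m)
open import Data.Nat.ListAction using (sum)
open import Data.Nat.Tactic.RingSolver using (solve-∀)
open import Data.Integer as ℤ using (ℤ; -[1+_]; 0ℤ; _⊖_)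
import Data.Integer.Properties as ℤₚ
open import Data.Rational as ℚ using (ℚ; toℚᵘ)
import Data.Rational.Properties as ℚₚ
open import Data.Rational.Unnormalised as ℚᵘ using (mkℚᵘ)
import Data.Rational.Unnormalised.Properties as ℚᵘₚ
open import Data.Fin using (zero; suc; toℕ; fromℕ<)
open import Data.Fin.Properties using (toℕ<n; toℕ-fromℕ<)
open import Data.Vec using (Vec; []; _∷_; lookup)
open import Data.Vec.Properties using (lookup∘tabulate)
open import Data.List using (List; []; _∷_; _++_; replicate; length; map)
open import Data.List.Properties using (++-assoc; ++-identityʳ; length-map; ≡-dec)
open import Data.List.Relation.Unary.All as All using (All; []; _∷_)
import Data.List.Relation.Unary.All.Properties as Allₚ
open import Data.Product using (Σ; ∃; _,_; proj₁; proj₂)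
open import Data.Sum using (inj₁; inj₂; [_,_])
open import Data.Empty using (⊥; ⊥-elim)
open import Data.Unit using (⊤; tt)
open import Relation.Nullary using (¬_; yes; no; _×-dec_; _⊎-dec_)
open import Relation.Binary.PropositionalEquality hiding ([_])
open import Relation.Binary.Construct.Closure.ReflexiveTransitive using (Star; ε; _◅_)
open import Function using (_∘_; case_of_)
open import Function.Bundles using (_⇔_; mk⇔; Equivalence)

head₀ : List ℕ → ℕ
head₀ [] = 0
head₀ (x ∷ _) = x

nth : List ℕ → ℕ → ℕ
nth [] i = 0
nth (x ∷ xs) zero = x
nth (x ∷ xs) (suc i) = nth xs i

Descending : List ℕ → Set
Descending [] = ⊤
Descending (x ∷ xs) = head₀ xs ≤ x × Descending xs

-- Every sequence is read with an implicit trailing 0, so the descent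
-- condition is also imposed at the last entry.
infix 4 _≼_
_≼_ : List ℕ → List ℕ → Set
[] ≼ [] = ⊤
[] ≼ (_ ∷ _) = ⊥
(_ ∷ _) ≼ [] = ⊥
(x ∷ xs) ≼ (y ∷ ys) = x ≤ y × (head₀ ys < y → head₀ xs < x) × xs ≼ ys

≼-refl : ∀ u → u ≼ u
≼-refl [] = tt
≼-refl (x ∷ u) = ≤-refl , (λ h → h) , ≼-refl u

≼-trans : ∀ {u v w} → u ≼ v → v ≼ w → u ≼ w
≼-trans {[]} {[]} {[]} _ _ = tt
≼-trans {_ ∷ _} {_ ∷ _} {_ ∷ _} (x≤y , dx , u≼v) (y≤z , dy , v≼w) =
  ≤-trans x≤y y≤z , dx ∘ dy , ≼-trans u≼v v≼w

≼-head : ∀ {u v} → u ≼ v → head₀ u ≤ head₀ v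
≼-head {[]} {[]} _ = z≤n
≼-head {_ ∷ _} {_ ∷ _} (x≤y , _) = x≤y

≼-length : ∀ {u v} → u ≼ v → length u ≡ length v
≼-length {[]} {[]} _ = refl
≼-length {_ ∷ _} {_ ∷ _} (_ , _ , u≼v) = cong suc (≼-length u≼v)

≼-sum : ∀ {u v} → u ≼ v → sum u ≤ sum v
≼-sum {[]} {[]} _ = z≤n
≼-sum {_ ∷ _} {_ ∷ _} (x≤y , _ , u≼v) = +-mono-≤ x≤y (≼-sum u≼v)

≼∧sum≥⇒≡ : ∀ {u v} → u ≼ v → sum v ≤ sum u → u ≡ v
≼∧sum≥⇒≡ {[]} {[]} _ _ = refl
≼∧sum≥⇒≡ {x ∷ u} {y ∷ v} (x≤y , _ , u≼v) sum≥ =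
  cong₂ _∷_ x≡y (≼∧sum≥⇒≡ u≼v (+-cancelˡ-≤ y _ _ (≤-trans sum≥ (+-monoˡ-≤ (sum u) x≤y))))
  where
  x≡y : x ≡ y
  x≡y = ≤-antisym x≤y (+-cancelʳ-≤ (sum v) _ _ (≤-trans sum≥ (+-monoʳ-≤ x (≼-sum u≼v))))

Staircase : ℕ → List ℕ → Set
Staircase m [] = ⊤
Staircase m (x ∷ xs) = m * suc (length xs) ≤ x × Staircase m xs

≼-staircase : ∀ m {u v} → u ≼ v → Staircase m u → Staircase m v
≼-staircase m {[]} {[]} _ _ = tt
≼-staircase m {x ∷ u} {y ∷ v} (x≤y , _ , u≼v) (bx , bu) =
  subst (λ k → m * suc k ≤ y) (≼-length u≼v) (≤-trans bx x≤y) , ≼-staircase m u≼v bu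

Positive : List ℕ → Set
Positive = All (0 <_)

0<m*suc : ∀ m .{{_ : NonZero m}} k → 0 < m * suc k
0<m*suc m k = <-≤-trans (ℕ.>-nonZero⁻¹ m) (m≤m*n m (suc k))

staircase⇒positive : ∀ m {u} → .{{NonZero m}} → Staircase m u → Positive u
staircase⇒positive m {[]} _ = []
staircase⇒positive m {x ∷ u} (bx , bu) =
  <-≤-trans (0<m*suc m (length u)) bx ∷ staircase⇒positive m bu

-- A Dyck path is determined by its down-counts

downs : ℕ → Path
downs k = replicate k D

ups : ℕ → Path
ups k = replicate k U

downCounts : Path → List ℕ
downCounts [] = []
downCounts (U ∷ p) = countD p ∷ downCounts p
downCounts (D ∷ p) = downCounts p

-- the path with d down steps in total and down-counts l (when head₀ l ≤ d)
fromDownCounts : ℕ → List ℕ → Path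
fromDownCounts d [] = downs d
fromDownCounts d (x ∷ xs) = downs (d ∸ x) ++ U ∷ fromDownCounts x xs

m∸n≡suc[m∸suc[n]] : ∀ {m n} → n < m → m ∸ n ≡ suc (m ∸ suc n)
m∸n≡suc[m∸suc[n]] = +-∸-assoc 1

head-downCounts : ∀ p → head₀ (downCounts p) ≤ countD p
head-downCounts [] = z≤n
head-downCounts (U ∷ p) = ≤-refl
head-downCounts (D ∷ p) = m≤n⇒m≤1+n (head-downCounts p)

downCounts-descending : ∀ p → Descending (downCounts p)
downCounts-descending [] = tt
downCounts-descending (U ∷ p) = head-downCounts p , downCounts-descending p
downCounts-descending (D ∷ p) = downCounts-descending p

length-downCounts : ∀ p → length (downCounts p) ≡ countU p
length-downCounts [] = refl
length-downCounts (U ∷ p) = cong suc (length-downCounts p)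
length-downCounts (D ∷ p) = length-downCounts p

nth-downCounts : ∀ p i → nth (downCounts p) i ≡ countD (afterUp (suc i) p)
nth-downCounts [] i = refl
nth-downCounts (U ∷ p) zero = refl
nth-downCounts (U ∷ p) (suc i) = nth-downCounts p i
nth-downCounts (D ∷ p) i = nth-downCounts p i

fromDownCounts-suc : ∀ d l → head₀ l ≤ d → fromDownCounts (suc d) l ≡ D ∷ fromDownCounts d l
fromDownCounts-suc d [] _ = refl
fromDownCounts-suc d (x ∷ xs) x≤d rewrite +-∸-assoc 1 x≤d = refl

fromDownCounts-repeat : ∀ c l → fromDownCounts c (c ∷ l) ≡ U ∷ fromDownCounts c l
fromDownCounts-repeat c l rewrite n∸n≡0 c = refl

fromDownCounts-downCounts : ∀ p → fromDownCounts (countD p) (downCounts p) ≡ p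
fromDownCounts-downCounts [] = refl
fromDownCounts-downCounts (U ∷ p) =
  trans (fromDownCounts-repeat (countD p) (downCounts p)) (cong (U ∷_) (fromDownCounts-downCounts p))
fromDownCounts-downCounts (D ∷ p) =
  trans (fromDownCounts-suc (countD p) (downCounts p) (head-downCounts p))
        (cong (D ∷_) (fromDownCounts-downCounts p))

downCounts-downs++ : ∀ k r → downCounts (downs k ++ r) ≡ downCounts r
downCounts-downs++ zero r = refl
downCounts-downs++ (suc k) r = downCounts-downs++ k r

countD-downs++ : ∀ k r → countD (downs k ++ r) ≡ k + countD r
countD-downs++ zero r = refl
countD-downs++ (suc k) r = cong suc (countD-downs++ k r)

countU-downs++ : ∀ k r → countU (downs k ++ r) ≡ countU r
countU-downs++ zero r = refl
countU-downs++ (suc k) r = countU-downs++ k r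

countD-ups++ : ∀ k r → countD (ups k ++ r) ≡ countD r
countD-ups++ zero r = refl
countD-ups++ (suc k) r = countD-ups++ k r

downs++[] : ∀ k → downs k ++ [] ≡ downs k
downs++[] k = ++-identityʳ (downs k)

record FromDownCounts (d : ℕ) (l : List ℕ) : Set where
  field
    downCounts≡ : downCounts (fromDownCounts d l) ≡ l
    countD≡     : countD (fromDownCounts d l) ≡ d
    countU≡     : countU (fromDownCounts d l) ≡ length l

downCounts-fromDownCounts : ∀ d l → head₀ l ≤ d → Descending l → FromDownCounts d l
downCounts-fromDownCounts d [] _ _ = record
  { downCounts≡ = subst (λ p → downCounts p ≡ []) (downs++[] d) (downCounts-downs++ d [])
  ; countD≡ = subst (λ p → countD p ≡ d) (downs++[] d) (trans (countD-downs++ d []) (+-identityʳ d))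
  ; countU≡ = subst (λ p → countU p ≡ 0) (downs++[] d) (countU-downs++ d [])
  }
downCounts-fromDownCounts d (x ∷ xs) x≤d (xs≤x , xs↓) = record
  { downCounts≡ = trans (downCounts-downs++ (d ∸ x) _) (cong₂ _∷_ R.countD≡ R.downCounts≡)
  ; countD≡ = trans (countD-downs++ (d ∸ x) _) (trans (cong ((d ∸ x) +_) R.countD≡) (m∸n+n≡m x≤d))
  ; countU≡ = trans (countU-downs++ (d ∸ x) _) (cong suc R.countU≡)
  }
  where module R = FromDownCounts (downCounts-fromDownCounts x xs xs≤x xs↓)

downCounts-injective : ∀ p q → countD p ≡ countD q → downCounts p ≡ downCounts q → p ≡ q
downCounts-injective p q eD eF = begin
  p                                      ≡⟨ fromDownCounts-downCounts p ⟨
  fromDownCounts (countD p) (downCounts p) ≡⟨ cong₂ fromDownCounts eD eF ⟩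
  fromDownCounts (countD q) (downCounts q) ≡⟨ fromDownCounts-downCounts q ⟩
  q                                      ∎
  where open ≡-Reasoning

record DyckCode (N : ℕ) (l : List ℕ) : Set where
  field
    descending : Descending l
    staircase  : Staircase 1 l
    length≡    : length l ≡ N
    head≤      : head₀ l ≤ N

staircase₁-head : ∀ {x xs} → Staircase 1 (x ∷ xs) → suc (length xs) ≤ x
staircase₁-head {x} (b , _) = subst (_≤ x) (*-identityˡ _) b

dyck-countD : ∀ {h p} → DyckFrom h p → countD p ≡ h + countU p
dyck-countD end = refl
dyck-countD {h} (up {p = p} d) = trans (dyck-countD d) (sym (+-suc h (countU p)))
dyck-countD (down d) = cong suc (dyck-countD d)

dyck-staircase : ∀ {h p} → DyckFrom h p → Staircase 1 (downCounts p)
dyck-staircase end = tt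
dyck-staircase {h} (up {p = p} d) =
  subst (_≤ countD p) (sym (*-identityˡ _)) (begin
    suc (length (downCounts p)) ≡⟨ cong suc (length-downCounts p) ⟩
    suc (countU p)              ≤⟨ s≤s (m≤n+m _ h) ⟩
    suc h + countU p            ≡⟨ dyck-countD d ⟨
    countD p                    ∎) ,
  dyck-staircase d
  where open ≤-Reasoning
dyck-staircase (down d) = dyck-staircase d

dyck⇒dyckCode : ∀ N p → IsDyck N p → DyckCode N (downCounts p)
dyck⇒dyckCode N p (d , eU , eD) = record
  { descending = downCounts-descending p
  ; staircase  = dyck-staircase d
  ; length≡    = trans (length-downCounts p) eU
  ; head≤      = subst (head₀ (downCounts p) ≤_) eD (head-downCounts p)
  }

downs-dyck : ∀ k {h r} → DyckFrom h r → DyckFrom (k + h) (downs k ++ r)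
downs-dyck zero d = d
downs-dyck (suc k) d = down (downs-dyck k d)

fromDownCounts-dyck : ∀ d l → Descending l → Staircase 1 l → head₀ l ≤ d →
  DyckFrom (d ∸ length l) (fromDownCounts d l)
fromDownCounts-dyck d [] _ _ _ =
  subst (DyckFrom d) (downs++[] d) (subst (λ k → DyckFrom k (downs d ++ [])) (+-identityʳ d) (downs-dyck d end))
fromDownCounts-dyck d (x ∷ xs) (xs≤x , xs↓) b x≤d =
  subst (λ k → DyckFrom k (downs (d ∸ x) ++ U ∷ fromDownCounts x xs)) heights (downs-dyck (d ∸ x) (up tail))
  where
  len<x = staircase₁-head b
  tail : DyckFrom (suc (x ∸ suc (length xs))) (fromDownCounts x xs)
  tail = subst (λ k → DyckFrom k (fromDownCounts x xs)) (m∸n≡suc[m∸suc[n]] len<x)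
           (fromDownCounts-dyck x xs xs↓ (proj₂ b) xs≤x)
  heights : (d ∸ x) + (x ∸ suc (length xs)) ≡ d ∸ suc (length xs)
  heights = trans (sym (+-∸-assoc (d ∸ x) len<x)) (cong (_∸ suc (length xs)) (m∸n+n≡m x≤d))

dyckCode⇒dyck : ∀ N l → DyckCode N l → IsDyck N (fromDownCounts N l)
dyckCode⇒dyck N l c =
  subst (λ k → DyckFrom k (fromDownCounts N l)) (trans (cong (N ∸_) length≡) (n∸n≡0 N))
    (fromDownCounts-dyck N l descending staircase head≤) ,
  trans R.countU≡ length≡ , R.countD≡
  where
  open DyckCode c
  module R = FromDownCounts (downCounts-fromDownCounts N l head≤ descending)

fromDownCounts-downCounts-dyck : ∀ {N} p → IsDyck N p → fromDownCounts N (downCounts p) ≡ p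
fromDownCounts-downCounts-dyck p (_ , _ , eD) =
  trans (cong (λ d → fromDownCounts d (downCounts p)) (sym eD)) (fromDownCounts-downCounts p)

-- Moves raise the down-counts in the order ≼

move-prefix : ∀ zs {p q} → Move p q → Move (zs ++ p) (zs ++ q)
move-prefix zs (xs , ys , k , 1≤k , refl , refl) =
  zs ++ xs , ys , k , 1≤k , sym (++-assoc zs xs _) , sym (++-assoc zs xs _)

downCounts-≼-swap : ∀ k ys → downCounts (ups k ++ D ∷ ys) ≼ downCounts (ups k ++ D ∷ D ∷ ys)
downCounts-≼-swap zero ys = ≼-refl (downCounts ys)
downCounts-≼-swap (suc zero) ys = n≤1+n _ , (λ _ → s≤s (head-downCounts ys)) , ≼-refl (downCounts ys)
downCounts-≼-swap (suc (suc k)) ys =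
  subst₂ _≤_ (sym (countD-ups++ (suc k) (D ∷ ys))) (sym (countD-ups++ (suc k) (D ∷ D ∷ ys))) (n≤1+n _) ,
  (λ h → ⊥-elim (n≮n _ h)) ,
  downCounts-≼-swap (suc k) ys

downCounts-≼-prefix : ∀ xs {p q} → countD p ≡ countD q → downCounts p ≼ downCounts q →
  countD (xs ++ p) ≡ countD (xs ++ q) × downCounts (xs ++ p) ≼ downCounts (xs ++ q)
downCounts-≼-prefix [] eD p≼q = eD , p≼q
downCounts-≼-prefix (D ∷ xs) eD p≼q =
  let eD′ , p≼q′ = downCounts-≼-prefix xs eD p≼q in cong suc eD′ , p≼q′
downCounts-≼-prefix (U ∷ xs) eD p≼q =
  let eD′ , p≼q′ = downCounts-≼-prefix xs eD p≼q in
  eD′ , ≤-reflexive eD′ , (λ h → ≤-<-trans (≼-head p≼q′) (subst (_ <_) (sym eD′) h)) , p≼q′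

move⇒≼ : ∀ {p q} → Move p q → downCounts p ≼ downCounts q
move⇒≼ (xs , ys , k , _ , refl , refl) =
  proj₂ (downCounts-≼-prefix xs eD (downCounts-≼-swap k ys))
  where
  eD : countD (D ∷ ups k ++ D ∷ ys) ≡ countD (ups k ++ D ∷ D ∷ ys)
  eD = trans (cong suc (countD-ups++ k (D ∷ ys))) (sym (countD-ups++ k (D ∷ D ∷ ys)))

≤𝔻⇒≼ : ∀ {N p q} → p ≤𝔻[ N ] q → downCounts p ≼ downCounts q
≤𝔻⇒≼ ε = ≼-refl _
≤𝔻⇒≼ ((_ , _ , p↝q) ◅ q≤r) = ≼-trans (move⇒≼ p↝q) (≤𝔻⇒≼ q≤r)

-- Conversely, ≼ between codes of Dyck paths is realised by moves

liftRun : ℕ → List ℕ → List ℕ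
liftRun c [] = []
liftRun c (x ∷ xs) with x ≟ c
... | yes _ = suc x ∷ liftRun c xs
... | no _ = x ∷ xs

fromDownCounts-liftRun : ∀ c xs → 1 ≤ c → Descending (c ∷ xs) → Σ ℕ λ k → Σ Path λ ys →
  (U ∷ fromDownCounts c xs ≡ ups (suc k) ++ D ∷ ys) ×
  (U ∷ fromDownCounts (suc c) (liftRun c xs) ≡ ups (suc k) ++ D ∷ D ∷ ys)
fromDownCounts-liftRun (suc c) [] _ _ = 0 , downs c , refl , refl
fromDownCounts-liftRun c (x ∷ xs) 1≤c (x≤c , xs↓) with x ≟ c
... | yes refl =
  let k , ys , e , e′ = fromDownCounts-liftRun x xs 1≤c xs↓ in
  suc k , ys ,
  cong (U ∷_) (trans (fromDownCounts-repeat x xs) e) ,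
  cong (U ∷_) (trans (fromDownCounts-repeat (suc x) (liftRun x xs)) e′)
... | no x≢c = 0 , downs (c ∸ suc x) ++ U ∷ fromDownCounts x xs ,
  cong (λ t → U ∷ downs t ++ U ∷ fromDownCounts x xs) (m∸n≡suc[m∸suc[n]] x<c) ,
  cong (λ t → U ∷ downs t ++ U ∷ fromDownCounts x xs)
    (trans (m∸n≡suc[m∸suc[n]] (m≤n⇒m≤1+n x<c)) (cong suc (m∸n≡suc[m∸suc[n]] x<c)))
  where x<c = ≤∧≢⇒< x≤c x≢c

liftRun-≼-upper : ∀ c xs y ys → c < y → Descending (c ∷ xs) → Descending (y ∷ ys) →
  (c ∷ xs) ≼ (y ∷ ys) → (suc c ∷ liftRun c xs) ≼ (y ∷ ys)
liftRun-≼-upper c [] y [] c<y _ _ _ = c<y , (λ _ → s≤s z≤n) , tt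
liftRun-≼-upper c (x ∷ xs) y (y′ ∷ ys) c<y (x≤c , xs↓) (y′≤y , ys↓) (_ , dc , xs≼ys) with x ≟ c
... | yes refl = c<y , (λ h → ⊥-elim (n≮n x (dc h))) ,
  liftRun-≼-upper x xs y′ ys (subst (x <_) (sym y′≡y) c<y) xs↓ ys↓ xs≼ys
  where
  y′≡y : y′ ≡ y
  y′≡y with m≤n⇒m<n∨m≡n y′≤y
  ... | inj₁ y′<y = ⊥-elim (n≮n x (dc y′<y))
  ... | inj₂ y′≡y = y′≡y
... | no _ = c<y , (λ _ → s≤s x≤c) , xs≼ys

liftRun-≼-lower : ∀ c xs → 1 ≤ c → Descending (c ∷ xs) → (c ∷ xs) ≼ (suc c ∷ liftRun c xs)
liftRun-≼-lower c [] 1≤c _ = n≤1+n c , (λ _ → 1≤c) , tt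
liftRun-≼-lower c (x ∷ xs) 1≤c (x≤c , xs↓) with x ≟ c
... | yes refl = n≤1+n x , (λ h → ⊥-elim (n≮n _ h)) , liftRun-≼-lower x xs 1≤c xs↓
... | no x≢c = n≤1+n c , (λ _ → ≤∧≢⇒< x≤c x≢c) , ≼-refl (x ∷ xs)

liftRun-descending : ∀ c xs → Descending (c ∷ xs) → Descending (suc c ∷ liftRun c xs)
liftRun-descending c [] _ = z≤n , tt
liftRun-descending c (x ∷ xs) (x≤c , xs↓) with x ≟ c
... | yes refl = ≤-refl , liftRun-descending x xs xs↓
... | no _ = m≤n⇒m≤1+n x≤c , xs↓

liftRun-sum : ∀ c xs → sum xs ≤ sum (liftRun c xs)
liftRun-sum c [] = z≤n
liftRun-sum c (x ∷ xs) with x ≟ c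
... | yes refl = m≤n⇒m≤1+n (+-monoʳ-≤ x (liftRun-sum x xs))
... | no _ = ≤-refl

D∷downs++ : ∀ j r → D ∷ (downs j ++ r) ≡ downs j ++ D ∷ r
D∷downs++ zero r = refl
D∷downs++ (suc j) r = cong (D ∷_) (D∷downs++ j r)

fromDownCounts-∷≡downs++D∷U∷ : ∀ d x xs → x < d →
  fromDownCounts d (x ∷ xs) ≡ downs (d ∸ suc x) ++ D ∷ U ∷ fromDownCounts x xs
fromDownCounts-∷≡downs++D∷U∷ d x xs x<d =
  trans (cong (λ t → downs t ++ U ∷ fromDownCounts x xs) (m∸n≡suc[m∸suc[n]] x<d)) (D∷downs++ (d ∸ suc x) _)

record MoveTowards (d : ℕ) (u v : List ℕ) : Set where
  field
    next       : List ℕ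
    move       : Move (fromDownCounts d u) (fromDownCounts d next)
    u≼next     : u ≼ next
    next≼v     : next ≼ v
    descending : Descending next
    sum<       : sum u < sum next

-- At the first entry where u and v differ, u has x < y; raising x together
-- with the following entries equal to x is a move D U^k D → U^k D D.
moveTowards : ∀ d u v → Descending u → Descending v → Positive u → head₀ v ≤ d →
  u ≼ v → u ≢ v → MoveTowards d u v
moveTowards d [] [] _ _ _ _ _ u≢v = ⊥-elim (u≢v refl)
moveTowards d (x ∷ xs) (y ∷ ys) (xs≤x , xs↓) (ys≤y , ys↓) (1≤x ∷ xs⁺) y≤d (x≤y , dx , xs≼ys) u≢v
  with x ≟ y
... | yes refl = record
  { next       = x ∷ R.next
  ; move       = move-prefix (downs (d ∸ x)) (move-prefix (U ∷ []) R.move)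
  ; u≼next     = ≤-refl , ≤-<-trans (≼-head R.u≼next) , R.u≼next
  ; next≼v     = ≤-refl , ≤-<-trans (≼-head R.next≼v) , R.next≼v
  ; descending = ≤-trans (≼-head R.next≼v) ys≤y , R.descending
  ; sum<       = +-monoʳ-< x R.sum<
  }
  where
  module R = MoveTowards (moveTowards x xs ys xs↓ ys↓ xs⁺ ys≤y xs≼ys (u≢v ∘ cong (x ∷_)))
... | no x≢y with fromDownCounts-liftRun x xs 1≤x (xs≤x , xs↓)
...   | k , ys′ , shape-u , shape-next = record
  { next       = suc x ∷ liftRun x xs
  ; move       = downs (d ∸ suc x) , ys′ , suc k , s≤s z≤n ,
                 trans (fromDownCounts-∷≡downs++D∷U∷ d x xs (<-≤-trans x<y y≤d))
                       (cong (λ r → downs (d ∸ suc x) ++ D ∷ r) shape-u) ,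
                 cong (downs (d ∸ suc x) ++_) shape-next
  ; u≼next     = liftRun-≼-lower x xs 1≤x (xs≤x , xs↓)
  ; next≼v     = liftRun-≼-upper x xs y ys x<y (xs≤x , xs↓) (ys≤y , ys↓) (x≤y , dx , xs≼ys)
  ; descending = liftRun-descending x xs (xs≤x , xs↓)
  ; sum<       = s≤s (+-monoʳ-≤ x (liftRun-sum x xs))
  }
  where x<y = ≤∧≢⇒< x≤y x≢y

-- The fuel t bounds the number of moves, since each one raises the sum.
≼⇒moves : ∀ t N u v → DyckCode N u → DyckCode N v → u ≼ v → sum v ≤ t + sum u →
  Star (MoveIn N) (fromDownCounts N u) (fromDownCounts N v)
≼⇒moves t N u v cu cv u≼v fuel with ≡-dec _≟_ u v
... | yes refl = ε
≼⇒moves zero N u v cu cv u≼v fuel | no u≢v = ⊥-elim (u≢v (≼∧sum≥⇒≡ u≼v fuel))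
≼⇒moves (suc t) N u v cu cv u≼v fuel | no u≢v =
  (dyckCode⇒dyck N u cu , dyckCode⇒dyck N next cnext , move) ◅ ≼⇒moves t N next v cnext cv next≼v fuel′
  where
  module U = DyckCode cu
  module V = DyckCode cv
  open MoveTowards (moveTowards N u v U.descending V.descending (staircase⇒positive 1 U.staircase)
                      V.head≤ u≼v u≢v)
  cnext : DyckCode N next
  cnext = record
    { descending = descending
    ; staircase  = ≼-staircase 1 u≼next U.staircase
    ; length≡    = trans (≼-length next≼v) V.length≡
    ; head≤      = ≤-trans (≼-head next≼v) V.head≤
    }
  fuel′ : sum v ≤ t + sum next
  fuel′ = ≤-trans fuel (≤-trans (≤-reflexive (sym (+-suc t (sum u)))) (+-monoʳ-≤ t sum<))

≤𝔻⇔≼ : ∀ N p q → IsDyck N p → IsDyck N q → p ≤𝔻[ N ] q ⇔ downCounts p ≼ downCounts q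
≤𝔻⇔≼ N p q dp dq = mk⇔ ≤𝔻⇒≼ λ p≼q →
  subst₂ (Star (MoveIn N)) (fromDownCounts-downCounts-dyck p dp) (fromDownCounts-downCounts-dyck q dq)
    (≼⇒moves (sum (downCounts q)) N _ _ (dyck⇒dyckCode N p dp) (dyck⇒dyckCode N q dq) p≼q (m≤m+n _ _))

-- (length of the leading ascent, lengths of the ascents right after each down step)
ascents₀ : Path → ℕ × List ℕ
ascents₀ [] = 0 , []
ascents₀ (U ∷ p) = suc (proj₁ (ascents₀ p)) , proj₂ (ascents₀ p)
ascents₀ (D ∷ p) = 0 , proj₁ (ascents₀ p) ∷ proj₂ (ascents₀ p)

-- (length of the leading descent, lengths of the descents right after each up step)
descents₀ : Path → ℕ × List ℕ
descents₀ [] = 0 , []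
descents₀ (D ∷ p) = suc (proj₁ (descents₀ p)) , proj₂ (descents₀ p)
descents₀ (U ∷ p) = 0 , proj₁ (descents₀ p) ∷ proj₂ (descents₀ p)

toList : ℕ × List ℕ → List ℕ
toList (x , xs) = x ∷ xs

dropZeros : List ℕ → List ℕ
dropZeros [] = []
dropZeros (zero ∷ xs) = dropZeros xs
dropZeros (suc x ∷ xs) = suc x ∷ dropZeros xs

incHead : List ℕ → List ℕ
incHead [] = 1 ∷ []
incHead (x ∷ xs) = suc x ∷ xs

addStep-U : ∀ r → Σ ℕ λ k → Σ (List (Step × ℕ)) λ r′ → addStep U r ≡ (U , k) ∷ r′
addStep-U [] = 1 , [] , refl
addStep-U ((U , k) ∷ r) = suc k , r , refl
addStep-U ((D , k) ∷ r) = 1 , (D , k) ∷ r , refl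

addStep-D : ∀ r → Σ ℕ λ k → Σ (List (Step × ℕ)) λ r′ → addStep D r ≡ (D , k) ∷ r′
addStep-D [] = 1 , [] , refl
addStep-D ((D , k) ∷ r) = suc k , r , refl
addStep-D ((U , k) ∷ r) = 1 , (U , k) ∷ r , refl

runsOfU-addStep-D : ∀ r → runsOf U (addStep D r) ≡ runsOf U r
runsOfU-addStep-D [] = refl
runsOfU-addStep-D ((U , k) ∷ r) = refl
runsOfU-addStep-D ((D , k) ∷ r) = refl

runsOfD-addStep-U : ∀ r → runsOf D (addStep U r) ≡ runsOf D r
runsOfD-addStep-U [] = refl
runsOfD-addStep-U ((D , k) ∷ r) = refl
runsOfD-addStep-U ((U , k) ∷ r) = refl

ascentLengths-UU : ∀ p → ascentLengths (U ∷ U ∷ p) ≡ incHead (ascentLengths (U ∷ p))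
ascentLengths-UU p with addStep-U (runs p)
... | _ , _ , e rewrite e = refl

ascentLengths-UD : ∀ p → ascentLengths (U ∷ D ∷ p) ≡ 1 ∷ ascentLengths (D ∷ p)
ascentLengths-UD p with addStep-D (runs p)
... | _ , _ , e rewrite e = refl

descentLengths-DD : ∀ p → descentLengths (D ∷ D ∷ p) ≡ incHead (descentLengths (D ∷ p))
descentLengths-DD p with addStep-D (runs p)
... | _ , _ , e rewrite e = refl

descentLengths-DU : ∀ p → descentLengths (D ∷ U ∷ p) ≡ 1 ∷ descentLengths (U ∷ p)
descentLengths-DU p with addStep-U (runs p)
... | _ , _ , e rewrite e = refl

ascentLengths≡dropZeros : ∀ p → ascentLengths p ≡ dropZeros (toList (ascents₀ p))
ascentLengths≡dropZeros [] = refl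
ascentLengths≡dropZeros (D ∷ p) = trans (runsOfU-addStep-D (runs p)) (ascentLengths≡dropZeros p)
ascentLengths≡dropZeros (U ∷ []) = refl
ascentLengths≡dropZeros (U ∷ D ∷ p) =
  trans (ascentLengths-UD p) (cong (1 ∷_) (ascentLengths≡dropZeros (D ∷ p)))
ascentLengths≡dropZeros (U ∷ U ∷ p) =
  trans (ascentLengths-UU p) (cong incHead (ascentLengths≡dropZeros (U ∷ p)))

descentLengths≡dropZeros : ∀ p → descentLengths p ≡ dropZeros (toList (descents₀ p))
descentLengths≡dropZeros [] = refl
descentLengths≡dropZeros (U ∷ p) = trans (runsOfD-addStep-U (runs p)) (descentLengths≡dropZeros p)
descentLengths≡dropZeros (D ∷ []) = refl
descentLengths≡dropZeros (D ∷ U ∷ p) =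
  trans (descentLengths-DU p) (cong (1 ∷_) (descentLengths≡dropZeros (U ∷ p)))
descentLengths≡dropZeros (D ∷ D ∷ p) =
  trans (descentLengths-DD p) (cong incHead (descentLengths≡dropZeros (D ∷ p)))

all-dropZeros⁻ : ∀ {P : ℕ → Set} → P 0 → ∀ l → All P (dropZeros l) → All P l
all-dropZeros⁻ P0 [] _ = []
all-dropZeros⁻ P0 (zero ∷ l) ps = P0 ∷ all-dropZeros⁻ P0 l ps
all-dropZeros⁻ P0 (suc x ∷ l) (px ∷ ps) = px ∷ all-dropZeros⁻ P0 l ps

all-dropZeros⁺ : ∀ {P : ℕ → Set} l → All P l → All P (dropZeros l)
all-dropZeros⁺ [] _ = []
all-dropZeros⁺ (zero ∷ l) (_ ∷ ps) = all-dropZeros⁺ l ps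
all-dropZeros⁺ (suc x ∷ l) (px ∷ ps) = px ∷ all-dropZeros⁺ l ps

-- m-Dyck paths: the down-counts come in blocks of m equal entries

repeatEach : ℕ → List ℕ → List ℕ
repeatEach m [] = []
repeatEach m (x ∷ xs) = replicate m x ++ repeatEach m xs

-- the ascents of p are multiples of m, when k up steps of its first ascent precede p
AscentsDivisible : ℕ → ℕ → Path → Set
AscentsDivisible m k p = m ∣ k + proj₁ (ascents₀ p) × All (m ∣_) (proj₂ (ascents₀ p))

leadingAscent≤countU : ∀ p → proj₁ (ascents₀ p) ≤ countU p
leadingAscent≤countU [] = z≤n
leadingAscent≤countU (U ∷ p) = s≤s (leadingAscent≤countU p)
leadingAscent≤countU (D ∷ p) = z≤n

∣∧<⇒≡0 : ∀ {m t} → m ∣ t → t < m → t ≡ 0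
∣∧<⇒≡0 {t = zero} _ _ = refl
∣∧<⇒≡0 {t = suc t} m∣t t<m = ⊥-elim (>⇒∤ t<m m∣t)

-- t more up steps complete the current block of m up steps
downCounts-repeatEach : ∀ m .{{_ : NonZero m}} k t p → AscentsDivisible m k p → t < m → m ∣ k + t →
  t ≤ countU p → ∃ λ w → downCounts p ≡ replicate t (countD p) ++ repeatEach m w
downCounts-repeatEach m k t [] _ _ _ t≤0 with n≤0⇒n≡0 t≤0
... | refl = [] , refl
downCounts-repeatEach m k t (D ∷ p) (m∣k+0 , m∣a ∷ m∣as) t<m m∣k+t _
  with ∣∧<⇒≡0 (∣m+n∣m⇒∣n m∣k+t (subst (m ∣_) (+-identityʳ k) m∣k+0)) t<m
... | refl = downCounts-repeatEach m 0 0 p (m∣a , m∣as) (ℕ.>-nonZero⁻¹ m) (m ∣0) z≤n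
downCounts-repeatEach m k (suc t) (U ∷ p) (m∣k+a , m∣as) t<m m∣k+t (s≤s t≤) =
  let w , e = downCounts-repeatEach m (suc k) t p (subst (m ∣_) (+-suc k _) m∣k+a , m∣as)
                (<⇒≤ t<m) (subst (m ∣_) (+-suc k t) m∣k+t) t≤
  in w , cong (countD p ∷_) e
downCounts-repeatEach m@(suc m′) k zero (U ∷ p) (m∣k+a , m∣as) _ m∣k+0 _ =
  let w , e = downCounts-repeatEach m (suc k) m′ p (subst (m ∣_) (+-suc k _) m∣k+a , m∣as) ≤-refl
                (subst (m ∣_) (+-suc k m′) (∣m∣n⇒∣m+n m∣k ∣-refl)) m′≤countU
  in countD p ∷ w , cong (countD p ∷_) e
  where
  m∣k : m ∣ k
  m∣k = subst (m ∣_) (+-identityʳ k) m∣k+0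
  m′≤countU : m′ ≤ countU p
  m′≤countU = ≤-trans (s≤s⁻¹ (∣⇒≤ (∣m+n∣m⇒∣n m∣k+a m∣k))) (leadingAscent≤countU p)

length-replicate++ : ∀ k (x : ℕ) xs → length (replicate k x ++ xs) ≡ k + length xs
length-replicate++ zero x xs = refl
length-replicate++ (suc k) x xs = cong suc (length-replicate++ k x xs)

length-repeatEach : ∀ m w → length (repeatEach m w) ≡ m * length w
length-repeatEach m [] = sym (*-zeroʳ m)
length-repeatEach m (x ∷ w) =
  trans (length-replicate++ m x _) (trans (cong (m +_) (length-repeatEach m w)) (sym (*-suc m (length w))))

mDyck⇒repeatEach : ∀ m n .{{_ : NonZero m}} p → IsMDyck m n p →
  ∃ λ w → downCounts p ≡ repeatEach m w × length w ≡ n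
mDyck⇒repeatEach m n p ((_ , eU , _) , m∣ascents) = w , e , *-cancelˡ-≡ (length w) n m length≡
  where
  divisible : AscentsDivisible m 0 p
  divisible with all-dropZeros⁻ (m ∣0) (toList (ascents₀ p))
                   (subst (All (m ∣_)) (ascentLengths≡dropZeros p) m∣ascents)
  ... | m∣a ∷ m∣as = m∣a , m∣as
  grouped = downCounts-repeatEach m 0 0 p divisible (ℕ.>-nonZero⁻¹ m) (m ∣0) z≤n
  w = proj₁ grouped
  e = proj₂ grouped
  length≡ : m * length w ≡ m * n
  length≡ = begin
    m * length w                  ≡⟨ length-repeatEach m w ⟨
    length (repeatEach m w)       ≡⟨ cong length e ⟨
    length (downCounts p)         ≡⟨ length-downCounts p ⟩
    countU p                      ≡⟨ eU ⟩
    m * n                         ∎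
    where open ≡-Reasoning

ascentsDivisible-D∷ : ∀ m p → AscentsDivisible m 0 p → AscentsDivisible m 0 (D ∷ p)
ascentsDivisible-D∷ m p (m∣a , m∣as) = m ∣0 , m∣a ∷ m∣as

ascentsDivisible-downs++ : ∀ m k p → AscentsDivisible m 0 p → AscentsDivisible m 0 (downs k ++ p)
ascentsDivisible-downs++ m zero p ad = ad
ascentsDivisible-downs++ m (suc k) p ad = ascentsDivisible-D∷ m (downs k ++ p) (ascentsDivisible-downs++ m k p ad)

ascents₀-ups++ : ∀ a r → ascents₀ (ups a ++ r) ≡ (a + proj₁ (ascents₀ r) , proj₂ (ascents₀ r))
ascents₀-ups++ zero r = refl
ascents₀-ups++ (suc a) r rewrite ascents₀-ups++ a r = refl

fromDownCounts-replicate++ : ∀ j x l → fromDownCounts x (replicate j x ++ l) ≡ ups j ++ fromDownCounts x l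
fromDownCounts-replicate++ zero x l = refl
fromDownCounts-replicate++ (suc j) x l =
  trans (fromDownCounts-repeat x (replicate j x ++ l)) (cong (U ∷_) (fromDownCounts-replicate++ j x l))

fromDownCounts-ascentsDivisible : ∀ m .{{_ : NonZero m}} d w →
  AscentsDivisible m 0 (fromDownCounts d (repeatEach m w))
fromDownCounts-ascentsDivisible m d [] =
  subst (AscentsDivisible m 0) (downs++[] d) (ascentsDivisible-downs++ m d [] (m ∣0 , []))
fromDownCounts-ascentsDivisible m@(suc m′) d (x ∷ w) =
  ascentsDivisible-downs++ m (d ∸ x) _ (subst (AscentsDivisible m 0) (sym block) ups-divisible)
  where
  rest = fromDownCounts x (repeatEach m w)
  block : U ∷ fromDownCounts x (replicate m′ x ++ repeatEach m w) ≡ ups m ++ rest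
  block = cong (U ∷_) (fromDownCounts-replicate++ m′ x _)
  ups-divisible : AscentsDivisible m 0 (ups m ++ rest)
  ups-divisible =
    let m∣a , m∣as = fromDownCounts-ascentsDivisible m x w in
    subst (λ a → m ∣ proj₁ a × All (m ∣_) (proj₂ a)) (sym (ascents₀-ups++ m rest))
      (∣m∣n⇒∣m+n ∣-refl m∣a , m∣as)

-- Mirrored m-Dyck paths: the down-counts are multiples of m

DescentsDivisible : ℕ → Path → Set
DescentsDivisible m p = All (m ∣_) (toList (descents₀ p))

countD≡sum-descents₀ : ∀ p → countD p ≡ sum (toList (descents₀ p))
countD≡sum-descents₀ [] = refl
countD≡sum-descents₀ (U ∷ p) = countD≡sum-descents₀ p
countD≡sum-descents₀ (D ∷ p) = cong suc (countD≡sum-descents₀ p)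

∣-sum : ∀ {m} l → All (m ∣_) l → m ∣ sum l
∣-sum [] _ = _ ∣0
∣-sum (x ∷ l) (m∣x ∷ m∣l) = ∣m∣n⇒∣m+n m∣x (∣-sum l m∣l)

-- the leading descent of p follows no up step, so it need not be divisible
downCounts-divisible : ∀ m p → All (m ∣_) (proj₂ (descents₀ p)) → All (m ∣_) (downCounts p)
downCounts-divisible m [] _ = []
downCounts-divisible m (D ∷ p) m∣ds = downCounts-divisible m p m∣ds
downCounts-divisible m (U ∷ p) m∣ds =
  subst (m ∣_) (sym (countD≡sum-descents₀ p)) (∣-sum _ m∣ds) ∷ downCounts-divisible m p (All.tail m∣ds)

afterUp-descentsDivisible : ∀ m k p → All (m ∣_) (proj₂ (descents₀ p)) →
  DescentsDivisible m (afterUp (suc k) p)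
afterUp-descentsDivisible m k [] _ = m ∣0 ∷ []
afterUp-descentsDivisible m k (D ∷ p) m∣ds = afterUp-descentsDivisible m k p m∣ds
afterUp-descentsDivisible m zero (U ∷ p) m∣ds = m∣ds
afterUp-descentsDivisible m (suc k) (U ∷ p) (_ ∷ m∣ds) = afterUp-descentsDivisible m k p m∣ds

sum-map-/-dropZeros : ∀ m .{{_ : NonZero m}} l →
  sum (map (_/ m) (dropZeros l)) ≡ sum (map (_/ m) l)
sum-map-/-dropZeros m [] = refl
sum-map-/-dropZeros m (zero ∷ l) =
  trans (sum-map-/-dropZeros m l) (sym (cong (_+ sum (map (_/ m) l)) (0/n≡0 m)))
sum-map-/-dropZeros m (suc x ∷ l) = cong (suc x / m +_) (sum-map-/-dropZeros m l)

sum-map-/ : ∀ m .{{_ : NonZero m}} l → All (m ∣_) l → sum (map (_/ m) l) ≡ sum l / m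
sum-map-/ m [] _ = sym (0/n≡0 m)
sum-map-/ m (x ∷ l) (m∣x ∷ m∣l) =
  trans (cong (x / m +_) (sum-map-/ m l m∣l)) (sym (+-distrib-/-∣ˡ (sum l) m∣x))

blocks≡countD/ : ∀ m .{{_ : NonZero m}} p → DescentsDivisible m p → blocks m p ≡ countD p / m
blocks≡countD/ m p m∣ds = begin
  sum (map (_/ m) (descentLengths p))
    ≡⟨ cong (λ l → sum (map (_/ m) l)) (descentLengths≡dropZeros p) ⟩
  sum (map (_/ m) (dropZeros (toList (descents₀ p))))  ≡⟨ sum-map-/-dropZeros m _ ⟩
  sum (map (_/ m) (toList (descents₀ p)))              ≡⟨ sum-map-/ m _ m∣ds ⟩
  sum (toList (descents₀ p)) / m                       ≡⟨ cong (_/ m) (countD≡sum-descents₀ p) ⟨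
  countD p / m                                         ∎
  where open ≡-Reasoning

descents₀-downs++ : ∀ b r → descents₀ (downs b ++ r) ≡ (b + proj₁ (descents₀ r) , proj₂ (descents₀ r))
descents₀-downs++ zero r = refl
descents₀-downs++ (suc b) r rewrite descents₀-downs++ b r = refl

descents₀-downs : ∀ b → descents₀ (downs b) ≡ (b , [])
descents₀-downs zero = refl
descents₀-downs (suc b) rewrite descents₀-downs b = refl

∣-∸ : ∀ {m a b} → b ≤ a → m ∣ a → m ∣ b → m ∣ a ∸ b
∣-∸ {m} b≤a m∣a m∣b = ∣m+n∣m⇒∣n (subst (m ∣_) (sym (m+[n∸m]≡n b≤a)) m∣a) m∣b

fromDownCounts-descentsDivisible : ∀ m d l → m ∣ d → All (m ∣_) l → Descending l → head₀ l ≤ d →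
  DescentsDivisible m (fromDownCounts d l)
fromDownCounts-descentsDivisible m d [] m∣d _ _ _ rewrite descents₀-downs d = m∣d ∷ []
fromDownCounts-descentsDivisible m d (x ∷ xs) m∣d (m∣x ∷ m∣xs) (xs≤x , xs↓) x≤d
  rewrite descents₀-downs++ (d ∸ x) (U ∷ fromDownCounts x xs) =
  subst (m ∣_) (sym (+-identityʳ _)) (∣-∸ x≤d m∣d m∣x) ∷
  fromDownCounts-descentsDivisible m x xs m∣x m∣xs xs↓ xs≤x

-- The join may only descend where both arguments descend; z is its last
-- entry and a, b are the last entries of the arguments.
joinFrom : ℕ → ℕ → ℕ → List ℕ → List ℕ → List ℕ
joinFrom z a b (x ∷ xs) (y ∷ ys) with (x <? a) ×-dec (y <? b)
... | yes _ = x ⊔ y ∷ joinFrom (x ⊔ y) x y xs ys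
... | no _ = z ∷ joinFrom z x y xs ys
joinFrom _ _ _ _ _ = []

infixr 6 _∨_
_∨_ : List ℕ → List ℕ → List ℕ
(x ∷ xs) ∨ (y ∷ ys) = x ⊔ y ∷ joinFrom (x ⊔ y) x y xs ys
_ ∨ _ = []

joinFrom-comm : ∀ z a b xs ys → joinFrom z a b xs ys ≡ joinFrom z b a ys xs
joinFrom-comm z a b [] [] = refl
joinFrom-comm z a b [] (_ ∷ _) = refl
joinFrom-comm z a b (_ ∷ _) [] = refl
joinFrom-comm z a b (x ∷ xs) (y ∷ ys) with x <? a | y <? b
... | yes _ | yes _ rewrite ⊔-comm x y = cong (y ⊔ x ∷_) (joinFrom-comm (y ⊔ x) x y xs ys)
... | yes _ | no _ = cong (z ∷_) (joinFrom-comm z x y xs ys)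
... | no _ | yes _ = cong (z ∷_) (joinFrom-comm z x y xs ys)
... | no _ | no _ = cong (z ∷_) (joinFrom-comm z x y xs ys)

joinFrom-upper : ∀ z a b xs ys → a ≤ z → 0 < a → Positive xs → Descending (a ∷ xs) →
  length xs ≡ length ys → (a ∷ xs) ≼ (z ∷ joinFrom z a b xs ys)
joinFrom-upper z a b [] [] a≤z 0<a _ _ _ = a≤z , (λ _ → 0<a) , tt
joinFrom-upper z a b (x ∷ xs) (y ∷ ys) a≤z 0<a (0<x ∷ xs⁺) (x≤a , xs↓) e
  with (x <? a) ×-dec (y <? b)
... | yes (x<a , _) = a≤z , (λ _ → x<a) ,
  joinFrom-upper (x ⊔ y) x y xs ys (m≤m⊔n x y) 0<x xs⁺ xs↓ (suc-injective e)
... | no _ = a≤z , (λ z<z → ⊥-elim (n≮n z z<z)) ,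
  joinFrom-upper z x y xs ys (≤-trans x≤a a≤z) 0<x xs⁺ xs↓ (suc-injective e)

joinFrom-descending : ∀ z a b xs ys → a ≤ z → b ≤ z → Descending (a ∷ xs) → Descending (b ∷ ys) →
  Descending (z ∷ joinFrom z a b xs ys)
joinFrom-descending z a b [] _ _ _ _ _ = z≤n , tt
joinFrom-descending z a b (x ∷ xs) [] _ _ _ _ = z≤n , tt
joinFrom-descending z a b (x ∷ xs) (y ∷ ys) a≤z b≤z (x≤a , xs↓) (y≤b , ys↓)
  with (x <? a) ×-dec (y <? b)
... | yes (x<a , y<b) = ⊔-lub (≤-trans (<⇒≤ x<a) a≤z) (≤-trans (<⇒≤ y<b) b≤z) ,
  joinFrom-descending (x ⊔ y) x y xs ys (m≤m⊔n x y) (m≤n⊔m x y) xs↓ ys↓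
... | no _ = ≤-refl , joinFrom-descending z x y xs ys (≤-trans x≤a a≤z) (≤-trans y≤b b≤z) xs↓ ys↓

joinFrom-least : ∀ z a b xs ys c cs → z ≤ c → a ≤ z → b ≤ z →
  Descending (a ∷ xs) → Descending (b ∷ ys) →
  (a ∷ xs) ≼ (c ∷ cs) → (b ∷ ys) ≼ (c ∷ cs) → (z ∷ joinFrom z a b xs ys) ≼ (c ∷ cs)
joinFrom-least z a b [] [] c [] z≤c a≤z _ _ _ (_ , da , _) _ = z≤c , (λ 0<c → ≤-trans (da 0<c) a≤z) , tt
joinFrom-least z a b (x ∷ xs) (y ∷ ys) c (c′ ∷ cs) z≤c a≤z b≤z (x≤a , xs↓) (y≤b , ys↓)
  (_ , da , xs≼cs) (_ , db , ys≼cs)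
  with (x <? a) ×-dec (y <? b)
... | yes (x<a , y<b) = z≤c , (λ _ → ⊔-lub (<-≤-trans x<a a≤z) (<-≤-trans y<b b≤z)) ,
  joinFrom-least (x ⊔ y) x y xs ys c′ cs (⊔-lub (≼-head xs≼cs) (≼-head ys≼cs)) (m≤m⊔n x y) (m≤n⊔m x y)
    xs↓ ys↓ xs≼cs ys≼cs
... | no ¬both = z≤c , (λ c′<c → ⊥-elim (¬both (da c′<c , db c′<c))) ,
  joinFrom-least z x y xs ys c′ cs (≤-trans z≤c (≮⇒≥ λ c′<c → ¬both (da c′<c , db c′<c)))
    (≤-trans x≤a a≤z) (≤-trans y≤b b≤z) xs↓ ys↓ xs≼cs ys≼cs
joinFrom-least _ _ _ [] (_ ∷ _) _ [] _ _ _ _ _ _ (_ , _ , ())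
joinFrom-least _ _ _ (_ ∷ _) _ _ [] _ _ _ _ _ (_ , _ , ()) _
joinFrom-least _ _ _ [] _ _ (_ ∷ _) _ _ _ _ _ (_ , _ , ()) _
joinFrom-least _ _ _ (_ ∷ _) [] _ (_ ∷ _) _ _ _ _ _ _ (_ , _ , ())

∨-comm : ∀ a b → a ∨ b ≡ b ∨ a
∨-comm [] [] = refl
∨-comm [] (_ ∷ _) = refl
∨-comm (_ ∷ _) [] = refl
∨-comm (x ∷ xs) (y ∷ ys) rewrite ⊔-comm x y = cong (y ⊔ x ∷_) (joinFrom-comm (y ⊔ x) x y xs ys)

∨-upperˡ : ∀ a b → Descending a → Positive a → length a ≡ length b → a ≼ a ∨ b
∨-upperˡ [] [] _ _ _ = tt
∨-upperˡ (x ∷ xs) (y ∷ ys) a↓ (0<x ∷ xs⁺) e =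
  joinFrom-upper (x ⊔ y) x y xs ys (m≤m⊔n x y) 0<x xs⁺ a↓ (suc-injective e)

record IsJoinOf (a b j : List ℕ) : Set where
  field
    upperˡ     : a ≼ j
    upperʳ     : b ≼ j
    descending : Descending j
    least      : ∀ c → a ≼ c → b ≼ c → j ≼ c

∨-isJoin : ∀ a b → Descending a → Descending b → Positive a → Positive b → length a ≡ length b →
  IsJoinOf a b (a ∨ b)
∨-isJoin a b a↓ b↓ a⁺ b⁺ e = record
  { upperˡ     = ∨-upperˡ a b a↓ a⁺ e
  ; upperʳ     = subst (b ≼_) (∨-comm b a) (∨-upperˡ b a b↓ b⁺ (sym e))
  ; descending = descending a b a↓ b↓
  ; least      = least a b a↓ b↓
  }
  where
  descending : ∀ a b → Descending a → Descending b → Descending (a ∨ b)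
  descending [] _ _ _ = tt
  descending (_ ∷ _) [] _ _ = tt
  descending (x ∷ xs) (y ∷ ys) a↓ b↓ =
    joinFrom-descending (x ⊔ y) x y xs ys (m≤m⊔n x y) (m≤n⊔m x y) a↓ b↓
  least : ∀ a b → Descending a → Descending b → ∀ c → a ≼ c → b ≼ c → a ∨ b ≼ c
  least [] [] _ _ [] _ _ = tt
  least (x ∷ xs) (y ∷ ys) a↓ b↓ (c ∷ cs) a≼c b≼c =
    joinFrom-least (x ⊔ y) x y xs ys c cs (⊔-lub (≼-head a≼c) (≼-head b≼c)) (m≤m⊔n x y) (m≤n⊔m x y)
      a↓ b↓ a≼c b≼c

∨-head : ∀ a b → head₀ (a ∨ b) ≤ head₀ a ⊔ head₀ b
∨-head [] _ = z≤n
∨-head (_ ∷ _) [] = z≤n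
∨-head (x ∷ _) (y ∷ _) = ≤-refl

-- The meet must descend wherever an argument does, and it descends as
-- little as possible; g is its last entry and a, b those of the arguments.
meetFrom : ℕ → ℕ → ℕ → List ℕ → List ℕ → List ℕ
meetFrom g a b (x ∷ xs) (y ∷ ys) with (x <? a) ⊎-dec (y <? b)
... | yes _ = x ⊓ y ⊓ (g ∸ 1) ∷ meetFrom (x ⊓ y ⊓ (g ∸ 1)) x y xs ys
... | no _ = g ∷ meetFrom g x y xs ys
meetFrom _ _ _ _ _ = []

infixr 7 _∧_
_∧_ : List ℕ → List ℕ → List ℕ
(x ∷ xs) ∧ (y ∷ ys) = x ⊓ y ∷ meetFrom (x ⊓ y) x y xs ys
_ ∧ _ = []

meetFrom-comm : ∀ g a b xs ys → meetFrom g a b xs ys ≡ meetFrom g b a ys xs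
meetFrom-comm g a b [] [] = refl
meetFrom-comm g a b [] (_ ∷ _) = refl
meetFrom-comm g a b (_ ∷ _) [] = refl
meetFrom-comm g a b (x ∷ xs) (y ∷ ys) with x <? a | y <? b
... | yes _ | yes _ rewrite ⊓-comm x y = cong (_ ∷_) (meetFrom-comm _ x y xs ys)
... | yes _ | no _ rewrite ⊓-comm x y = cong (_ ∷_) (meetFrom-comm _ x y xs ys)
... | no _ | yes _ rewrite ⊓-comm x y = cong (_ ∷_) (meetFrom-comm _ x y xs ys)
... | no _ | no _ = cong (g ∷_) (meetFrom-comm g x y xs ys)

length-meetFrom : ∀ g a b xs ys → length xs ≡ length ys → length (meetFrom g a b xs ys) ≡ length xs
length-meetFrom g a b [] [] _ = refl
length-meetFrom g a b (x ∷ xs) (y ∷ ys) e with (x <? a) ⊎-dec (y <? b)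
... | yes _ = cong suc (length-meetFrom _ x y xs ys (suc-injective e))
... | no _ = cong suc (length-meetFrom _ x y xs ys (suc-injective e))

meetStep-staircase : ∀ m .{{_ : NonZero m}} g x y k → m * suc (suc k) ≤ g → m * suc k ≤ x → m * suc k ≤ y →
  m * suc k ≤ x ⊓ y ⊓ (g ∸ 1)
meetStep-staircase m g x y k bg bx by = ⊓-glb (⊓-glb bx by) (begin
  m * suc k             ≡⟨ m+n∸m≡n 1 (m * suc k) ⟨
  suc (m * suc k) ∸ 1   ≤⟨ ∸-monoˡ-≤ 1 (≤-trans (+-monoˡ-≤ (m * suc k) (ℕ.>-nonZero⁻¹ m))
                                                 (≤-trans (≤-reflexive (sym (*-suc m (suc k)))) bg)) ⟩
  g ∸ 1                 ∎)
  where open ≤-Reasoning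

meetFrom-lower : ∀ m .{{_ : NonZero m}} g a b xs ys → m * suc (length xs) ≤ g → g ≤ a →
  Staircase m xs → Staircase m ys → length xs ≡ length ys → (g ∷ meetFrom g a b xs ys) ≼ (a ∷ xs)
meetFrom-lower m g a b [] [] bg g≤a _ _ _ = g≤a , (λ _ → <-≤-trans (0<m*suc m 0) bg) , tt
meetFrom-lower m g a b (x ∷ xs) (y ∷ ys) bg g≤a (bx , xs↑) (by , ys↑) e with (x <? a) ⊎-dec (y <? b)
... | yes _ = g≤a , (λ _ → ≤-<-trans (m⊓n≤n _ _) (∸-monoʳ-< z<s (<-≤-trans (0<m*suc m _) bg))) ,
  meetFrom-lower m _ x y xs ys (meetStep-staircase m g x y _ bg bx by′) (≤-trans (m⊓n≤m _ _) (m⊓n≤m _ _))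
    xs↑ ys↑ (suc-injective e)
  where by′ = subst (λ k → m * suc k ≤ y) (sym (suc-injective e)) by
... | no ¬any = g≤a , (λ x<a → ⊥-elim (¬any (inj₁ x<a))) ,
  meetFrom-lower m g x y xs ys (≤-trans (*-monoʳ-≤ m (n≤1+n _)) bg) (≤-trans g≤a (≮⇒≥ (¬any ∘ inj₁)))
    xs↑ ys↑ (suc-injective e)

meetFrom-descending : ∀ g a b xs ys → Descending (g ∷ meetFrom g a b xs ys)
meetFrom-descending g a b [] _ = z≤n , tt
meetFrom-descending g a b (x ∷ xs) [] = z≤n , tt
meetFrom-descending g a b (x ∷ xs) (y ∷ ys) with (x <? a) ⊎-dec (y <? b)
... | yes _ = ≤-trans (m⊓n≤n _ _) (m∸n≤m g 1) , meetFrom-descending _ x y xs ys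
... | no _ = ≤-refl , meetFrom-descending g x y xs ys

meetFrom-staircase : ∀ m .{{_ : NonZero m}} g a b xs ys → m * suc (length xs) ≤ g →
  Staircase m xs → Staircase m ys → length xs ≡ length ys → Staircase m (g ∷ meetFrom g a b xs ys)
meetFrom-staircase m g a b [] [] bg _ _ _ = bg , tt
meetFrom-staircase m g a b (x ∷ xs) (y ∷ ys) bg (bx , xs↑) (by , ys↑) e
  with (x <? a) ⊎-dec (y <? b)
... | yes _ =
  subst (λ k → m * suc k ≤ g) (sym (cong suc (length-meetFrom _ x y xs ys e′))) bg ,
  meetFrom-staircase m _ x y xs ys (meetStep-staircase m g x y _ bg bx by′) xs↑ ys↑ e′
  where
  e′ = suc-injective e
  by′ = subst (λ k → m * suc k ≤ y) (sym e′) by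
... | no _ =
  subst (λ k → m * suc k ≤ g) (sym (cong suc (length-meetFrom _ x y xs ys e′))) bg ,
  meetFrom-staircase m g x y xs ys (≤-trans (*-monoʳ-≤ m (n≤1+n _)) bg) xs↑ ys↑ e′
  where e′ = suc-injective e

meetFrom-greatest : ∀ g a b xs ys c cs → c ≤ g → Positive (a ∷ xs) → Descending (c ∷ cs) →
  (c ∷ cs) ≼ (a ∷ xs) → (c ∷ cs) ≼ (b ∷ ys) → (c ∷ cs) ≼ (g ∷ meetFrom g a b xs ys)
meetFrom-greatest g a b [] [] c [] c≤g (0<a ∷ _) _ (_ , dc , _) _ = c≤g , (λ _ → dc 0<a) , tt
meetFrom-greatest g a b (x ∷ xs) (y ∷ ys) c (c′ ∷ cs) c≤g (_ ∷ a⁺) (c′≤c , cs↓)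
  (_ , dca , cs≼xs) (_ , dcb , cs≼ys) with (x <? a) ⊎-dec (y <? b)
... | yes any = c≤g , (λ _ → c′<c) ,
  meetFrom-greatest _ x y xs ys c′ cs (⊓-glb (⊓-glb (≼-head cs≼xs) (≼-head cs≼ys)) c′≤g∸1) a⁺ cs↓ cs≼xs cs≼ys
  where
  c′<c = [ dca , dcb ] any
  c′≤g∸1 : c′ ≤ g ∸ 1
  c′≤g∸1 = ≤-trans (≤-reflexive (sym (m+n∸m≡n 1 c′))) (∸-monoˡ-≤ 1 (≤-trans c′<c c≤g))
... | no _ = c≤g , (λ g<g → ⊥-elim (n≮n g g<g)) ,
  meetFrom-greatest g x y xs ys c′ cs (≤-trans c′≤c c≤g) a⁺ cs↓ cs≼xs cs≼ys
meetFrom-greatest _ _ _ [] (_ ∷ _) _ [] _ _ _ _ (_ , _ , ())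
meetFrom-greatest _ _ _ (_ ∷ _) _ _ [] _ _ _ (_ , _ , ()) _
meetFrom-greatest _ _ _ [] _ _ (_ ∷ _) _ _ _ (_ , _ , ()) _
meetFrom-greatest _ _ _ (_ ∷ _) [] _ (_ ∷ _) _ _ _ _ (_ , _ , ())

∧-comm : ∀ a b → a ∧ b ≡ b ∧ a
∧-comm [] [] = refl
∧-comm [] (_ ∷ _) = refl
∧-comm (_ ∷ _) [] = refl
∧-comm (x ∷ xs) (y ∷ ys) rewrite ⊓-comm x y = cong (y ⊓ x ∷_) (meetFrom-comm (y ⊓ x) x y xs ys)

∧-lowerˡ : ∀ m .{{_ : NonZero m}} a b → Staircase m a → Staircase m b → length a ≡ length b → a ∧ b ≼ a
∧-lowerˡ m [] [] _ _ _ = tt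
∧-lowerˡ m (x ∷ xs) (y ∷ ys) (bx , xs↑) (by , ys↑) e =
  meetFrom-lower m (x ⊓ y) x y xs ys (⊓-glb bx (subst (λ k → m * suc k ≤ y) (sym e′) by)) (m⊓n≤m x y)
    xs↑ ys↑ e′
  where e′ = suc-injective e

record IsMeetOf (a b g : List ℕ) : Set where
  field
    lowerˡ     : g ≼ a
    lowerʳ     : g ≼ b
    descending : Descending g
    greatest   : ∀ c → Descending c → c ≼ a → c ≼ b → c ≼ g

∧-isMeet : ∀ m .{{_ : NonZero m}} a b → Staircase m a → Staircase m b → length a ≡ length b →
  IsMeetOf a b (a ∧ b)
∧-isMeet m a b a↑ b↑ e = record
  { lowerˡ     = ∧-lowerˡ m a b a↑ b↑ e
  ; lowerʳ     = subst (_≼ b) (∧-comm b a) (∧-lowerˡ m b a b↑ a↑ (sym e))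
  ; descending = descending a b
  ; greatest   = greatest a b a↑
  }
  where
  descending : ∀ a b → Descending (a ∧ b)
  descending [] _ = tt
  descending (_ ∷ _) [] = tt
  descending (x ∷ xs) (y ∷ ys) = meetFrom-descending (x ⊓ y) x y xs ys
  greatest : ∀ a b → Staircase m a → ∀ c → Descending c → c ≼ a → c ≼ b → c ≼ a ∧ b
  greatest [] [] _ [] _ _ _ = tt
  greatest (x ∷ xs) (y ∷ ys) a↑ (c ∷ cs) c↓ c≼a c≼b =
    meetFrom-greatest (x ⊓ y) x y xs ys c cs (⊓-glb (≼-head c≼a) (≼-head c≼b))
      (staircase⇒positive m a↑) c↓ c≼a c≼b

∧-staircase : ∀ m .{{_ : NonZero m}} a b → Staircase m a → Staircase m b → length a ≡ length b →
  Staircase m (a ∧ b)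
∧-staircase m [] [] _ _ _ = tt
∧-staircase m (x ∷ xs) (y ∷ ys) (bx , xs↑) (by , ys↑) e =
  meetFrom-staircase m (x ⊓ y) x y xs ys (⊓-glb bx (subst (λ k → m * suc k ≤ y) (sym e′) by)) xs↑ ys↑ e′
  where e′ = suc-injective e

infix 4 _≈_
_≈_ : ∀ {n} → Vec ℤ n → List ℕ → Set
[] ≈ [] = ⊤
[] ≈ (_ ∷ _) = ⊥
(_ ∷ _) ≈ [] = ⊥
(x ∷ u) ≈ (a ∷ w) = x ≡ ℤ.+ a × u ≈ w

≈-lookup : ∀ {n} {u : Vec ℤ n} {w} → u ≈ w → ∀ j → lookup u j ≡ ℤ.+ nth w (toℕ j)
≈-lookup {u = _ ∷ _} {_ ∷ _} (e , _) zero = e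
≈-lookup {u = _ ∷ _} {_ ∷ _} (_ , u≈w) (suc j) = ≈-lookup u≈w j

≈-length : ∀ {n} {u : Vec ℤ n} {w} → u ≈ w → length w ≡ n
≈-length {u = []} {[]} _ = refl
≈-length {u = _ ∷ _} {_ ∷ _} (_ , u≈w) = cong suc (≈-length u≈w)

≈-intro : ∀ {n} (u : Vec ℤ n) w → length w ≡ n → (∀ j → lookup u j ≡ ℤ.+ nth w (toℕ j)) → u ≈ w
≈-intro [] [] _ _ = tt
≈-intro (x ∷ u) (a ∷ w) e f = f zero , ≈-intro u w (suc-injective e) (f ∘ suc)

≈-functionalˡ : ∀ {n} {u v : Vec ℤ n} {w} → u ≈ w → v ≈ w → u ≡ v
≈-functionalˡ {u = []} {[]} {[]} _ _ = refl
≈-functionalˡ {u = _ ∷ _} {_ ∷ _} {_ ∷ _} (e , u≈w) (e′ , v≈w) =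
  cong₂ _∷_ (trans e (sym e′)) (≈-functionalˡ u≈w v≈w)

≈-functionalʳ : ∀ {n} {u : Vec ℤ n} {w w′} → u ≈ w → u ≈ w′ → w ≡ w′
≈-functionalʳ {u = []} {[]} {[]} _ _ = refl
≈-functionalʳ {u = _ ∷ _} {_ ∷ _} {_ ∷ _} (e , u≈w) (e′ , u≈w′) =
  cong₂ _∷_ (ℤₚ.+-injective (trans (sym e) e′)) (≈-functionalʳ u≈w u≈w′)

≈-nonNegative : ∀ {n} (u : Vec ℤ n) → (∀ j → 0ℤ ℤ.≤ lookup u j) → ∃ λ w → u ≈ w
≈-nonNegative [] _ = [] , tt
≈-nonNegative (x ∷ u) 0≤u =
  let w , u≈w = ≈-nonNegative u (0≤u ∘ suc) in
  ℤ.∣ x ∣ ∷ w , sym (ℤₚ.0≤i⇒+∣i∣≡i (0≤u zero)) , u≈w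

≈-lookup-fromℕ< : ∀ {n} {u : Vec ℤ n} {w} → u ≈ w → ∀ i (i<n : i < n) → lookup u (fromℕ< i<n) ≡ ℤ.+ nth w i
≈-lookup-fromℕ< {w = w} u≈w i i<n = trans (≈-lookup u≈w _) (cong (λ k → ℤ.+ nth w k) (toℕ-fromℕ< i<n))

nth-zero : ∀ w → nth w 0 ≡ head₀ w
nth-zero [] = refl
nth-zero (_ ∷ _) = refl

nth-beyond : ∀ w {i} → length w ≤ i → nth w i ≡ 0
nth-beyond [] _ = refl
nth-beyond (_ ∷ w) (s≤s h) = nth-beyond w h

positive-nth : ∀ {w i} → Positive w → i < length w → 0 < nth w i
positive-nth {_ ∷ _} {zero} (0<x ∷ _) _ = 0<x
positive-nth {_ ∷ _} {suc i} (_ ∷ w⁺) (s≤s i<n) = positive-nth w⁺ i<n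

descending-nth : ∀ w → Descending w → ∀ i → nth w (suc i) ≤ nth w i
descending-nth [] _ i = z≤n
descending-nth (x ∷ w) (h , _) zero = subst (_≤ x) (sym (nth-zero w)) h
descending-nth (_ ∷ w) (_ , w↓) (suc i) = descending-nth w w↓ i

nth-descending : ∀ w → (∀ i → nth w (suc i) ≤ nth w i) → Descending w
nth-descending [] _ = tt
nth-descending (x ∷ w) f = subst (_≤ x) (nth-zero w) (f 0) , nth-descending w (f ∘ suc)

descending-nth≤head : ∀ w → Descending w → ∀ i → nth w i ≤ head₀ w
descending-nth≤head [] _ i = z≤n
descending-nth≤head (x ∷ w) _ zero = ≤-refl
descending-nth≤head (x ∷ w) (h , w↓) (suc i) = ≤-trans (descending-nth≤head w w↓ i) h

staircase-nth : ∀ m w → Staircase m w → ∀ i → i < length w → m * (length w ∸ i) ≤ nth w i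
staircase-nth m (_ ∷ _) (h , _) zero _ = h
staircase-nth m (_ ∷ w) (_ , w↑) (suc i) (s≤s i<n) = staircase-nth m w w↑ i i<n

nth-staircase : ∀ m w → (∀ i → i < length w → m * (length w ∸ i) ≤ nth w i) → Staircase m w
nth-staircase m [] _ = tt
nth-staircase m (_ ∷ w) f = f 0 (s≤s z≤n) , nth-staircase m w (λ i i<n → f (suc i) (s≤s i<n))

≼-nth : ∀ {a b} → a ≼ b → ∀ i → nth a i ≤ nth b i
≼-nth {[]} {[]} _ i = z≤n
≼-nth {_ ∷ _} {_ ∷ _} (x≤y , _) zero = x≤y
≼-nth {_ ∷ _} {_ ∷ _} (_ , _ , a≼b) (suc i) = ≼-nth a≼b i

≼-descent : ∀ {a b} → a ≼ b → ∀ i → nth b (suc i) < nth b i → nth a (suc i) < nth a i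
≼-descent {[]} {[]} _ i ()
≼-descent {x ∷ a} {y ∷ b} (_ , d , _) zero h =
  subst (_< x) (sym (nth-zero a)) (d (subst (_< y) (nth-zero b) h))
≼-descent {_ ∷ _} {_ ∷ _} (_ , _ , a≼b) (suc i) h = ≼-descent a≼b i h

nth-≼ : ∀ a b → length a ≡ length b → (∀ i → nth a i ≤ nth b i) →
  (∀ i → nth b (suc i) < nth b i → nth a (suc i) < nth a i) → a ≼ b
nth-≼ [] [] _ _ _ = tt
nth-≼ (x ∷ a) (y ∷ b) e ≤ᵢ dᵢ =
  ≤ᵢ 0 , (λ h → subst (_< x) (nth-zero a) (dᵢ 0 (subst (_< y) (sym (nth-zero b)) h))) ,
  nth-≼ a b (suc-injective e) (≤ᵢ ∘ suc) (dᵢ ∘ suc)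

toℕ-fromℕ<-consecutive : ∀ {n i} (1+i<n : suc i < n) → toℕ (fromℕ< 1+i<n) ≡ suc (toℕ (fromℕ< (<⇒≤ 1+i<n)))
toℕ-fromℕ<-consecutive 1+i<n = trans (toℕ-fromℕ< 1+i<n) (cong suc (sym (toℕ-fromℕ< (<⇒≤ 1+i<n))))

≈-nonincreasing : ∀ {n} {u : Vec ℤ n} {w} → u ≈ w → Descending w → Nonincreasing u
≈-nonincreasing {w = w} u≈w w↓ i j j≡1+i =
  subst₂ ℤ._≤_ (sym (≈-lookup u≈w j)) (sym (≈-lookup u≈w i))
    (ℤ.+≤+ (subst (λ k → nth w k ≤ nth w (toℕ i)) (sym j≡1+i) (descending-nth w w↓ (toℕ i))))

≈-descending : ∀ {n} {u : Vec ℤ n} {w} → u ≈ w → Nonincreasing u → Descending w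
≈-descending {n} {u} {w} u≈w u↓ = nth-descending w step
  where
  step : ∀ i → nth w (suc i) ≤ nth w i
  step i with suc i <? n
  ... | yes 1+i<n = ℤₚ.drop‿+≤+ (subst₂ ℤ._≤_ (≈-lookup-fromℕ< u≈w (suc i) 1+i<n)
                      (≈-lookup-fromℕ< u≈w i (<⇒≤ 1+i<n))
                      (u↓ _ _ (toℕ-fromℕ<-consecutive 1+i<n)))
  ... | no 1+i≮n =
    subst (_≤ nth w i) (sym (nth-beyond w (subst (_≤ suc i) (sym (≈-length u≈w)) (≮⇒≥ 1+i≮n)))) z≤n

≼⇒⊴ : ∀ {n} {u v : Vec ℤ n} {a b} → u ≈ a → v ≈ b → a ≼ b → u ⊴ v
≼⇒⊴ {a = a} {b} u≈a v≈b a≼b =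
  (λ i → subst₂ ℤ._≤_ (sym (≈-lookup u≈a i)) (sym (≈-lookup v≈b i)) (ℤ.+≤+ (≼-nth a≼b (toℕ i)))) ,
  λ i j j≡1+i v-descends →
    subst₂ ℤ._<_ (sym (≈-lookup u≈a j)) (sym (≈-lookup u≈a i))
      (ℤ.+<+ (subst (λ k → nth a k < nth a (toℕ i)) (sym j≡1+i)
        (≼-descent a≼b (toℕ i) (subst (λ k → nth b k < nth b (toℕ i)) j≡1+i
          (ℤₚ.drop‿+<+ (subst₂ ℤ._<_ (≈-lookup v≈b j) (≈-lookup v≈b i) v-descends))))))

-- The descent at the last entry, which ⊴ does not see, comes from positivity.
⊴⇒≼ : ∀ {n} {u v : Vec ℤ n} {a b} → u ≈ a → v ≈ b → Positive a → u ⊴ v → a ≼ b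
⊴⇒≼ {n} {u} {v} {a} {b} u≈a v≈b a⁺ (u≤v , descents) =
  nth-≼ a b (trans (≈-length u≈a) (sym (≈-length v≈b))) pointwise descent
  where
  a-beyond : ∀ {i} → ¬ i < n → nth a i ≡ 0
  a-beyond i≮n = nth-beyond a (subst (_≤ _) (sym (≈-length u≈a)) (≮⇒≥ i≮n))
  b-beyond : ∀ {i} → ¬ i < n → nth b i ≡ 0
  b-beyond i≮n = nth-beyond b (subst (_≤ _) (sym (≈-length v≈b)) (≮⇒≥ i≮n))
  pointwise : ∀ i → nth a i ≤ nth b i
  pointwise i with i <? n
  ... | yes i<n = ℤₚ.drop‿+≤+ (subst₂ ℤ._≤_ (≈-lookup-fromℕ< u≈a i i<n) (≈-lookup-fromℕ< v≈b i i<n)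
                    (u≤v (fromℕ< i<n)))
  ... | no i≮n = subst (_≤ nth b i) (sym (a-beyond i≮n)) z≤n
  descent : ∀ i → nth b (suc i) < nth b i → nth a (suc i) < nth a i
  descent i h with suc i <? n | i <? n
  ... | yes 1+i<n | _ = ℤₚ.drop‿+<+ (subst₂ ℤ._<_ (≈-lookup-fromℕ< u≈a (suc i) 1+i<n)
                          (≈-lookup-fromℕ< u≈a i (<⇒≤ 1+i<n))
                          (descents _ _ (toℕ-fromℕ<-consecutive 1+i<n)
                            (subst₂ ℤ._<_ (sym (≈-lookup-fromℕ< v≈b (suc i) 1+i<n))
                              (sym (≈-lookup-fromℕ< v≈b i (<⇒≤ 1+i<n))) (ℤ.+<+ h))))
  ... | no 1+i≮n | yes i<n = subst (_< nth a i) (sym (a-beyond 1+i≮n))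
                               (positive-nth a⁺ (subst (i <_) (sym (≈-length u≈a)) i<n))
  ... | no 1+i≮n | no i≮n = ⊥-elim (n≮n 0 (subst₂ _<_ (b-beyond 1+i≮n) (b-beyond i≮n) h))

-- S is a class of Dyck paths of size N whose down-counts are the images
-- under embed of codes, and which f sends to the vectors representing
-- these codes; T describes the vectors representing codes.
record Coding (N k : ℕ) (S : Path → Set) (f : Path → Vec ℤ k) (T : Vec ℤ k → Set) : Set₁ where
  field
    Code             : List ℕ → Set
    code-descending  : ∀ {w} → Code w → Descending w
    code-positive    : ∀ {w} → Code w → Positive w
    code-length      : ∀ {w} → Code w → length w ≡ k
    embed            : List ℕ → List ℕ
    embed-≼          : ∀ {a b} → a ≼ b → embed a ≼ embed b
    embed-≼⁻¹        : ∀ {a b} → embed a ≼ embed b → a ≼ b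
    isDyck           : ∀ {p} → S p → IsDyck N p
    code             : ∀ {p} → S p → ∃ λ w → Code w × downCounts p ≡ embed w
    ≈-code           : ∀ {p w} → S p → Code w → downCounts p ≡ embed w → f p ≈ w
    decode-dyckCode  : ∀ {w} → Code w → DyckCode N (embed w)
    decode           : ∀ {w} → Code w → S (fromDownCounts N (embed w))
    T⇒code           : ∀ {u} → T u → ∃ λ w → u ≈ w × Code w
    code⇒T           : ∀ {u w} → u ≈ w → Code w → T u

module Coded {N k S f T} (coding : Coding N k S f T) where
  open Coding coding

  R : Path → Path → Set
  R p q = p ≤𝔻[ N ] q

  downCounts-decode : ∀ {w} → Code w → downCounts (fromDownCounts N (embed w)) ≡ embed w
  downCounts-decode cw = FromDownCounts.downCounts≡ (downCounts-fromDownCounts N _ head≤ descending)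
    where open DyckCode (decode-dyckCode cw)

  order : ∀ {p q a b} → S p → S q → downCounts p ≡ embed a → downCounts q ≡ embed b → R p q ⇔ a ≼ b
  order {p} {q} sp sq ea eb = mk⇔
    (λ p≤q → embed-≼⁻¹ (subst₂ _≼_ ea eb (Equivalence.to p≤q⇔ p≤q)))
    (λ a≼b → Equivalence.from p≤q⇔ (subst₂ _≼_ (sym ea) (sym eb) (embed-≼ a≼b)))
    where p≤q⇔ = ≤𝔻⇔≼ N p q (isDyck sp) (isDyck sq)

  isIsoOnto : IsIsoOnto S R T _⊴_ f
  isIsoOnto = image , injective , surjective , monotone
    where
    image : ∀ p → S p → T (f p)
    image p sp = let w , cw , e = code sp in code⇒T (≈-code sp cw e) cw
    injective : ∀ p q → S p → S q → f p ≡ f q → p ≡ q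
    injective p q sp sq fp≡fq =
      let a , ca , ea = code sp ; b , cb , eb = code sq
          a≡b = ≈-functionalʳ (subst (_≈ a) fp≡fq (≈-code sp ca ea)) (≈-code sq cb eb)
      in downCounts-injective p q (trans (proj₂ (proj₂ (isDyck sp))) (sym (proj₂ (proj₂ (isDyck sq)))))
           (trans ea (trans (cong embed a≡b) (sym eb)))
    surjective : ∀ u → T u → ∃ λ p → S p × f p ≡ u
    surjective u tu =
      let w , u≈w , cw = T⇒code tu in
      fromDownCounts N (embed w) , decode cw , ≈-functionalˡ (≈-code (decode cw) cw (downCounts-decode cw)) u≈w
    monotone : ∀ p q → S p → S q → R p q ⇔ (f p ⊴ f q)
    monotone p q sp sq =
      let a , ca , ea = code sp ; b , cb , eb = code sq
          ≈a = ≈-code sp ca ea ; ≈b = ≈-code sq cb eb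
          p≤q⇔ = order sp sq ea eb
      in mk⇔ (λ p≤q → ≼⇒⊴ ≈a ≈b (Equivalence.to p≤q⇔ p≤q))
             (λ fp⊴fq → Equivalence.from p≤q⇔ (⊴⇒≼ ≈a ≈b (code-positive ca) fp⊴fq))

  joinSemilattice : (∀ {a b} → Code a → Code b → Code (a ∨ b)) → IsJoinSemilattice S R
  joinSemilattice ∨-code p q sp sq with code sp | code sq
  ... | a , ca , ea | b , cb , eb =
    fromDownCounts N (embed j) , decode cj ,
    Equivalence.from (order sp sz ea ej) upperˡ ,
    Equivalence.from (order sq sz eb ej) upperʳ ,
    λ r sr p≤r q≤r →
      let c , cc , ec = code sr in
      Equivalence.from (order sz sr ej ec)
        (least c (Equivalence.to (order sp sr ea ec) p≤r) (Equivalence.to (order sq sr eb ec) q≤r))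
    where
    j = a ∨ b
    cj = ∨-code ca cb
    sz = decode cj
    ej = downCounts-decode cj
    open IsJoinOf (∨-isJoin a b (code-descending ca) (code-descending cb) (code-positive ca) (code-positive cb)
                    (trans (code-length ca) (sym (code-length cb))))

  meets : (∀ {a b} → Code a → Code b → Code (a ∧ b) × IsMeetOf a b (a ∧ b)) →
    ∀ p q → S p → S q → ∃ λ z → IsMeet S R p q z
  meets ∧-code p q sp sq with code sp | code sq
  ... | a , ca , ea | b , cb , eb =
    fromDownCounts N (embed g) , decode cg ,
    Equivalence.from (order sz sp eg ea) lowerˡ ,
    Equivalence.from (order sz sq eg eb) lowerʳ ,
    λ r sr r≤p r≤q →
      let c , cc , ec = code sr in
      Equivalence.from (order sr sz ec eg)
        (greatest c (code-descending cc) (Equivalence.to (order sr sp ec ea) r≤p)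
          (Equivalence.to (order sr sq ec eb) r≤q))
    where
    g = a ∧ b
    cg = proj₁ (∧-code ca cb)
    sz = decode cg
    eg = downCounts-decode cg
    open IsMeetOf (proj₂ (∧-code ca cb))

module _ {x : ℕ} where
  replicate++-descending : ∀ k E → head₀ E ≤ x → Descending E → Descending (replicate (suc k) x ++ E)
  replicate++-descending zero E h E↓ = h , E↓
  replicate++-descending (suc k) E h E↓ = ≤-refl , replicate++-descending k E h E↓

  replicate++-descending⁻¹ : ∀ k E → Descending (replicate (suc k) x ++ E) → head₀ E ≤ x × Descending E
  replicate++-descending⁻¹ zero E h = h
  replicate++-descending⁻¹ (suc k) E (_ , h) = replicate++-descending⁻¹ k E h

  replicate++-staircase : ∀ k E → suc (k + length E) ≤ x → Staircase 1 E → Staircase 1 (replicate (suc k) x ++ E)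
  replicate++-staircase zero E h E↑ = subst (_≤ x) (sym (*-identityˡ _)) h , E↑
  replicate++-staircase (suc k) E h E↑ =
    subst (_≤ x) (sym (trans (*-identityˡ _) (cong suc (length-replicate++ (suc k) x E)))) h ,
    replicate++-staircase k E (<⇒≤ h) E↑

  replicate++-staircase⁻¹ : ∀ k E → Staircase 1 (replicate (suc k) x ++ E) → suc (k + length E) ≤ x × Staircase 1 E
  replicate++-staircase⁻¹ zero E h = staircase₁-head h , proj₂ h
  replicate++-staircase⁻¹ (suc k) E h =
    subst (_≤ x) (cong suc (length-replicate++ (suc k) x E)) (staircase₁-head h) ,
    proj₂ (replicate++-staircase⁻¹ k E (proj₂ h))

module _ {x y : ℕ} where
  replicate++-≼ : ∀ k E E′ → x ≤ y → (head₀ E′ < y → head₀ E < x) → E ≼ E′ →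
    replicate (suc k) x ++ E ≼ replicate (suc k) y ++ E′
  replicate++-≼ zero E E′ x≤y d E≼E′ = x≤y , d , E≼E′
  replicate++-≼ (suc k) E E′ x≤y d E≼E′ = x≤y , (λ y<y → ⊥-elim (n≮n y y<y)) , replicate++-≼ k E E′ x≤y d E≼E′

  replicate++-≼⁻¹ : ∀ k E E′ → replicate (suc k) x ++ E ≼ replicate (suc k) y ++ E′ →
    x ≤ y × (head₀ E′ < y → head₀ E < x) × E ≼ E′
  replicate++-≼⁻¹ zero E E′ h = h
  replicate++-≼⁻¹ (suc k) E E′ (_ , _ , h) = replicate++-≼⁻¹ k E E′ h

nth-replicate++-< : ∀ k (x : ℕ) E {i} → i < k → nth (replicate k x ++ E) i ≡ x
nth-replicate++-< (suc k) x E {zero} _ = refl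
nth-replicate++-< (suc k) x E {suc i} (s≤s i<k) = nth-replicate++-< k x E i<k

nth-replicate++-+ : ∀ k (x : ℕ) E i → nth (replicate k x ++ E) (k + i) ≡ nth E i
nth-replicate++-+ zero x E i = refl
nth-replicate++-+ (suc k) x E i = nth-replicate++-+ k x E i

module _ (m′ : ℕ) where
  private m = suc m′

  head-repeatEach : ∀ w → head₀ (repeatEach m w) ≡ head₀ w
  head-repeatEach [] = refl
  head-repeatEach (x ∷ w) = refl

  repeatEach-descending : ∀ w → Descending w → Descending (repeatEach m w)
  repeatEach-descending [] _ = tt
  repeatEach-descending (x ∷ w) (h , w↓) =
    replicate++-descending m′ _ (subst (_≤ x) (sym (head-repeatEach w)) h) (repeatEach-descending w w↓)

  repeatEach-descending⁻¹ : ∀ w → Descending (repeatEach m w) → Descending w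
  repeatEach-descending⁻¹ [] _ = tt
  repeatEach-descending⁻¹ (x ∷ w) h =
    let h′ , r = replicate++-descending⁻¹ m′ _ h in
    subst (_≤ x) (head-repeatEach w) h′ , repeatEach-descending⁻¹ w r

  private
    length-block : ∀ w → suc (m′ + length (repeatEach m w)) ≡ m * suc (length w)
    length-block w = trans (cong (λ k → suc (m′ + k)) (length-repeatEach m w)) (sym (*-suc m (length w)))

  repeatEach-staircase : ∀ w → Staircase m w → Staircase 1 (repeatEach m w)
  repeatEach-staircase [] _ = tt
  repeatEach-staircase (x ∷ w) (h , w↑) =
    replicate++-staircase m′ _ (subst (_≤ x) (sym (length-block w)) h) (repeatEach-staircase w w↑)

  repeatEach-staircase⁻¹ : ∀ w → Staircase 1 (repeatEach m w) → Staircase m w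
  repeatEach-staircase⁻¹ [] _ = tt
  repeatEach-staircase⁻¹ (x ∷ w) h =
    let h′ , r = replicate++-staircase⁻¹ m′ _ h in
    subst (_≤ x) (length-block w) h′ , repeatEach-staircase⁻¹ w r

  repeatEach-≼ : ∀ {a b} → a ≼ b → repeatEach m a ≼ repeatEach m b
  repeatEach-≼ {[]} {[]} _ = tt
  repeatEach-≼ {x ∷ a} {y ∷ b} (x≤y , d , a≼b) =
    replicate++-≼ m′ _ _ x≤y
      (λ h → subst (_< x) (sym (head-repeatEach a)) (d (subst (_< y) (head-repeatEach b) h)))
      (repeatEach-≼ a≼b)

  repeatEach-≼⁻¹ : ∀ {a b} → repeatEach m a ≼ repeatEach m b → a ≼ b
  repeatEach-≼⁻¹ {[]} {[]} _ = tt
  repeatEach-≼⁻¹ {[]} {_ ∷ _} ()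
  repeatEach-≼⁻¹ {_ ∷ _} {[]} ()
  repeatEach-≼⁻¹ {x ∷ a} {y ∷ b} h =
    let x≤y , d , r = replicate++-≼⁻¹ m′ _ _ h in
    x≤y , (λ t → subst (_< x) (head-repeatEach a) (d (subst (_< y) (sym (head-repeatEach b)) t))) ,
    repeatEach-≼⁻¹ r

  nth-repeatEach : ∀ w j → nth (repeatEach m w) (m′ + m * j) ≡ nth w j
  nth-repeatEach [] j = refl
  nth-repeatEach (x ∷ w) zero =
    nth-replicate++-< m x _ (subst (_< m) (sym (trans (cong (m′ +_) (*-zeroʳ m)) (+-identityʳ m′))) ≤-refl)
  nth-repeatEach (x ∷ w) (suc j) = begin
    nth (replicate m x ++ repeatEach m w) (m′ + m * suc j)   ≡⟨ cong (nth (replicate m x ++ repeatEach m w)) index ⟩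
    nth (replicate m x ++ repeatEach m w) (m + (m′ + m * j)) ≡⟨ nth-replicate++-+ m x _ _ ⟩
    nth (repeatEach m w) (m′ + m * j)                        ≡⟨ nth-repeatEach w j ⟩
    nth w j                                                  ∎
    where
    open ≡-Reasoning
    index : m′ + m * suc j ≡ m + (m′ + m * j)
    index = shift m′ j
      where
      shift : ∀ m′ j → m′ + suc m′ * suc j ≡ suc m′ + (m′ + suc m′ * j)
      shift = solve-∀

record MCode (m n : ℕ) (w : List ℕ) : Set where
  field
    descending : Descending w
    length≡    : length w ≡ n
    staircase  : Staircase m w
    head≤      : head₀ w ≤ m * n

staircaseBound : ∀ m n i → i < n → ℤ.+ m ℤ.* (ℤ.+ n ℤ.- ℤ.+ suc i ℤ.+ ℤ.1ℤ) ≡ ℤ.+ (m * (n ∸ i))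
staircaseBound m n i i<n = trans (cong (ℤ.+ m ℤ.*_) n-i) (ℤₚ.+◃n≡+n (m * (n ∸ i)))
  where
  n-i : ℤ.+ n ℤ.- ℤ.+ suc i ℤ.+ ℤ.1ℤ ≡ ℤ.+ (n ∸ i)
  n-i = begin
    ℤ.+ n ℤ.- ℤ.+ suc i ℤ.+ ℤ.1ℤ ≡⟨ cong (ℤ._+ ℤ.1ℤ) (ℤₚ.⊖-≥ i<n) ⟩
    ℤ.+ (n ∸ suc i) ℤ.+ ℤ.1ℤ     ≡⟨ cong ℤ.+_ (+-comm (n ∸ suc i) 1) ⟩
    ℤ.+ suc (n ∸ suc i)          ≡⟨ cong ℤ.+_ (m∸n≡suc[m∸suc[n]] i<n) ⟨
    ℤ.+ (n ∸ i)                  ∎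
    where open ≡-Reasoning

≈-head≤ : ∀ {n} {u : Vec ℤ n} {w} b → u ≈ w → (∀ j → lookup u j ℤ.≤ ℤ.+ b) → head₀ w ≤ b
≈-head≤ {w = []} b _ _ = z≤n
≈-head≤ {u = _ ∷ _} {w = _ ∷ _} b (e , _) u≤b = ℤₚ.drop‿+≤+ (subst (ℤ._≤ ℤ.+ b) e (u≤b zero))

≈-≤ : ∀ {n} {u : Vec ℤ n} {w} b → u ≈ w → Descending w → head₀ w ≤ b → ∀ j → lookup u j ℤ.≤ ℤ.+ b
≈-≤ b u≈w w↓ w≤b j =
  subst (ℤ._≤ ℤ.+ b) (sym (≈-lookup u≈w j)) (ℤ.+≤+ (≤-trans (descending-nth≤head _ w↓ (toℕ j)) w≤b))

inSeqs⇒mCode : ∀ m n {u} → InSeqs m n u → ∃ λ w → u ≈ w × MCode m n w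
inSeqs⇒mCode m n {u} (u↓ , bounds) = w , u≈w , record
  { descending = ≈-descending u≈w u↓
  ; length≡    = ≈-length u≈w
  ; staircase  = nth-staircase m w above
  ; head≤      = ≈-head≤ (m * n) u≈w (proj₂ ∘ bounds)
  }
  where
  lower : ∀ j → ℤ.+ (m * (n ∸ toℕ j)) ℤ.≤ lookup u j
  lower j = subst (ℤ._≤ lookup u j) (staircaseBound m n (toℕ j) (toℕ<n j)) (proj₁ (bounds j))
  nonNegative = ≈-nonNegative u (λ j → ℤₚ.≤-trans (ℤ.+≤+ z≤n) (lower j))
  w = proj₁ nonNegative
  u≈w = proj₂ nonNegative
  above : ∀ i → i < length w → m * (length w ∸ i) ≤ nth w i
  above i i<len = subst (λ k → m * (k ∸ i) ≤ nth w i) (sym (≈-length u≈w))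
    (subst (λ k → m * (n ∸ k) ≤ nth w i) (toℕ-fromℕ< i<n)
      (ℤₚ.drop‿+≤+ (subst (ℤ.+ (m * (n ∸ toℕ (fromℕ< i<n))) ℤ.≤_) (≈-lookup-fromℕ< u≈w i i<n)
                     (lower (fromℕ< i<n)))))
    where i<n = subst (i <_) (≈-length u≈w) i<len

mCode⇒inSeqs : ∀ m n {u w} → u ≈ w → MCode m n w → InSeqs m n u
mCode⇒inSeqs m n {u} {w} u≈w cw =
  ≈-nonincreasing u≈w descending , λ j → lower j , ≈-≤ (m * n) u≈w descending head≤ j
  where
  open MCode cw
  lower : ∀ j → ℤ.+ m ℤ.* (ℤ.+ n ℤ.- ℤ.+ suc (toℕ j) ℤ.+ ℤ.1ℤ) ℤ.≤ lookup u j
  lower j = subst₂ ℤ._≤_ (sym (staircaseBound m n (toℕ j) (toℕ<n j))) (sym (≈-lookup u≈w j))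
    (ℤ.+≤+ (subst (λ k → m * (k ∸ toℕ j) ≤ nth w (toℕ j)) length≡
      (staircase-nth m w staircase (toℕ j) (subst (toℕ j <_) (sym length≡) (toℕ<n j)))))

φ-≈ : ∀ m′ n p w → downCounts p ≡ repeatEach (suc m′) w → length w ≡ n → φ (suc m′) n p ≈ w
φ-≈ m′ n p w e length≡ = ≈-intro (φ m n p) w length≡ λ j → trans (lookup∘tabulate _ j) (cong ℤ.+_ (begin
  countD (afterUp (m * suc (toℕ j)) p)        ≡⟨ cong (λ k → countD (afterUp k p)) (*-suc m (toℕ j)) ⟩
  countD (afterUp (suc (m′ + m * toℕ j)) p)   ≡⟨ nth-downCounts p _ ⟨
  nth (downCounts p) (m′ + m * toℕ j)         ≡⟨ cong (λ l → nth l (m′ + m * toℕ j)) e ⟩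
  nth (repeatEach m w) (m′ + m * toℕ j)       ≡⟨ nth-repeatEach m′ w (toℕ j) ⟩
  nth w (toℕ j)                               ∎))
  where
  m = suc m′
  open ≡-Reasoning

module _ (m′ n : ℕ) where
  private m = suc m′

  mDyck⇒mCode : ∀ {p} → IsMDyck m n p → ∃ λ w → MCode m n w × downCounts p ≡ repeatEach m w
  mDyck⇒mCode {p} sp@(dp , _) = w , record
    { descending = repeatEach-descending⁻¹ m′ w (subst Descending e descending)
    ; length≡    = length-w
    ; staircase  = repeatEach-staircase⁻¹ m′ w (subst (Staircase 1) e staircase)
    ; head≤      = subst (_≤ m * n) (trans (cong head₀ e) (head-repeatEach m′ w)) head≤
    } , e
    where
    open DyckCode (dyck⇒dyckCode (m * n) p dp)
    grouped = mDyck⇒repeatEach m n p sp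
    w = proj₁ grouped
    e = proj₁ (proj₂ grouped)
    length-w = proj₂ (proj₂ grouped)

  mCode⇒dyckCode : ∀ {w} → MCode m n w → DyckCode (m * n) (repeatEach m w)
  mCode⇒dyckCode {w} cw = record
    { descending = repeatEach-descending m′ w descending
    ; staircase  = repeatEach-staircase m′ w staircase
    ; length≡    = trans (length-repeatEach m w) (cong (m *_) length≡)
    ; head≤      = subst (_≤ m * n) (sym (head-repeatEach m′ w)) head≤
    }
    where open MCode cw

  mCode⇒mDyck : ∀ {w} → MCode m n w → IsMDyck m n (fromDownCounts (m * n) (repeatEach m w))
  mCode⇒mDyck {w} cw = dyckCode⇒dyck (m * n) (repeatEach m w) (mCode⇒dyckCode cw) ,
    subst (All (m ∣_)) (sym (ascentLengths≡dropZeros p)) (all-dropZeros⁺ _ (m∣a ∷ m∣as))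
    where
    p = fromDownCounts (m * n) (repeatEach m w)
    m∣a = proj₁ (fromDownCounts-ascentsDivisible m (m * n) w)
    m∣as = proj₂ (fromDownCounts-ascentsDivisible m (m * n) w)

  mDyckCoding : Coding (m * n) n (IsMDyck m n) (φ m n) (InSeqs m n)
  mDyckCoding = record
    { Code            = MCode m n
    ; code-descending = MCode.descending
    ; code-positive   = staircase⇒positive m ∘ MCode.staircase
    ; code-length     = MCode.length≡
    ; embed           = repeatEach m
    ; embed-≼         = repeatEach-≼ m′
    ; embed-≼⁻¹       = repeatEach-≼⁻¹ m′
    ; isDyck          = proj₁
    ; code            = mDyck⇒mCode
    ; ≈-code          = λ {p} {w} _ cw e → φ-≈ m′ n p w e (MCode.length≡ cw)
    ; decode-dyckCode = mCode⇒dyckCode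
    ; decode          = mCode⇒mDyck
    ; T⇒code          = inSeqs⇒mCode m n
    ; code⇒T          = mCode⇒inSeqs m n
    }

∨-mCode : ∀ m .{{_ : NonZero m}} n {a b} → MCode m n a → MCode m n b → MCode m n (a ∨ b)
∨-mCode m n {a} {b} ca cb = record
  { descending = descending
  ; length≡    = trans (sym (≼-length upperˡ)) A.length≡
  ; staircase  = ≼-staircase m upperˡ A.staircase
  ; head≤      = ≤-trans (∨-head a b) (⊔-lub A.head≤ B.head≤)
  }
  where
  module A = MCode ca
  module B = MCode cb
  open IsJoinOf (∨-isJoin a b A.descending B.descending (staircase⇒positive m A.staircase)
                  (staircase⇒positive m B.staircase) (trans A.length≡ (sym B.length≡)))

∧-mCode : ∀ m .{{_ : NonZero m}} n {a b} → MCode m n a → MCode m n b → MCode m n (a ∧ b) × IsMeetOf a b (a ∧ b)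
∧-mCode m n {a} {b} ca cb = record
  { descending = descending
  ; length≡    = trans (≼-length lowerˡ) A.length≡
  ; staircase  = ∧-staircase m a b A.staircase B.staircase length≡
  ; head≤      = ≤-trans (≼-head lowerˡ) A.head≤
  } , isMeet
  where
  module A = MCode ca
  module B = MCode cb
  length≡ = trans A.length≡ (sym B.length≡)
  isMeet = ∧-isMeet m a b A.staircase B.staircase length≡
  open IsMeetOf isMeet

mDyck-isLattice×isIsoOnto : ∀ m′ n → let m = suc m′ in
  IsLattice (IsMDyck m n) (λ p q → p ≤𝔻[ m * n ] q) ×
  IsIsoOnto (IsMDyck m n) (λ p q → p ≤𝔻[ m * n ] q) (InSeqs m n) _⊴_ (φ m n)
mDyck-isLattice×isIsoOnto m′ n = (joinSemilattice (∨-mCode (suc m′) n) , meets (∧-mCode (suc m′) n)) , isIsoOnto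
  where open Coded (mDyckCoding m′ n)

-- The rational lower bound n - (i-1)/m, cleared of denominators

mirroredBound : ℕ → ℕ → ℕ → ℚ
mirroredBound m′ n j = (ℤ.+ n ℚ./ 1) ℚ.- ((ℤ.+ suc j ℤ.- ℤ.1ℤ) ℚ./ suc m′)

module _ (m′ n j : ℕ) where
  private
    m = suc m′
    bound = mirroredBound m′ n j

    toℚᵘ-bound : toℚᵘ bound ℚᵘ.≃ mkℚᵘ (ℤ.+ n) 0 ℚᵘ.- mkℚᵘ (ℤ.+ j) m′
    toℚᵘ-bound = ℚᵘₚ.≃-trans (ℚₚ.toℚᵘ-homo-+ (ℤ.+ n ℚ./ 1) (ℚ.- (ℤ.+ j ℚ./ m)))
      (ℚᵘₚ.+-cong (ℚₚ.toℚᵘ-fromℚᵘ (mkℚᵘ (ℤ.+ n) 0))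
        (ℚᵘₚ.≃-trans (ℚₚ.toℚᵘ-homo‿- (ℤ.+ j ℚ./ m)) (ℚᵘₚ.-‿cong (ℚₚ.toℚᵘ-fromℚᵘ (mkℚᵘ (ℤ.+ j) m′)))))

    -- cross-multiplied numerator of the bound (over the denominator m)
    numerator : (ℤ.+ n ℤ.* ℤ.+ m ℤ.+ (ℤ.- ℤ.+ j) ℤ.* ℤ.+ 1) ℤ.* ℤ.+ 1 ≡ (n * m) ⊖ j
    numerator = trans (ℤₚ.*-identityʳ _)
      (trans (cong₂ ℤ._+_ (ℤₚ.+◃n≡+n (n * m)) (ℤₚ.*-identityʳ (ℤ.- ℤ.+ j))) (ℤₚ.m-n≡m⊖n (n * m) j))

    denominator : ∀ a → ℤ.+ a ℤ.* ℤ.+ suc (m′ + 0 * m) ≡ ℤ.+ (a * m)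
    denominator a = trans (ℤₚ.+◃n≡+n (a * suc (m′ + 0))) (cong (λ k → ℤ.+ (a * suc k)) (+-identityʳ m′))

    ⊖≤⇔ : ∀ x y → (x ⊖ j) ℤ.≤ ℤ.+ y ⇔ x ≤ y + j
    ⊖≤⇔ x y with ≤-total j x
    ... | inj₁ j≤x = mk⇔
      (λ h → ≤-trans (≤-reflexive (sym (m∸n+n≡m j≤x)))
               (+-monoˡ-≤ j (ℤₚ.drop‿+≤+ (subst (ℤ._≤ ℤ.+ y) (ℤₚ.⊖-≥ j≤x) h))))
      (λ h → subst (ℤ._≤ ℤ.+ y) (sym (ℤₚ.⊖-≥ j≤x)) (ℤ.+≤+ (m≤n+o⇒m∸n≤o x j (subst (x ≤_) (+-comm y j) h))))
    ... | inj₂ x≤j = mk⇔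
      (λ _ → ≤-trans x≤j (m≤n+m j y))
      (λ _ → ℤₚ.≤-trans (ℤₚ.⊖-monoˡ-≤ j x≤j) (subst (ℤ._≤ ℤ.+ y) (sym (ℤₚ.n⊖n≡0 j)) (ℤ.+≤+ z≤n)))

  mirroredBound⇔ : ∀ a → bound ℚ.≤ (ℤ.+ a ℚ./ 1) ⇔ n * m ≤ a * m + j
  mirroredBound⇔ a = mk⇔
    (λ h → case ℚᵘₚ.≤-respʳ-≃ toℚᵘ-a (ℚᵘₚ.≤-respˡ-≃ toℚᵘ-bound (ℚₚ.toℚᵘ-mono-≤ h)) of λ where
      (ℚᵘ.*≤* h′) → Equivalence.to (⊖≤⇔ (n * m) (a * m)) (subst₂ ℤ._≤_ numerator (denominator a) h′))
    (λ h → ℚₚ.toℚᵘ-cancel-≤ (ℚᵘₚ.≤-respʳ-≃ (ℚᵘₚ.≃-sym toℚᵘ-a) (ℚᵘₚ.≤-respˡ-≃ (ℚᵘₚ.≃-sym toℚᵘ-bound)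
      (ℚᵘ.*≤* (subst₂ ℤ._≤_ (sym numerator) (sym (denominator a)) (Equivalence.from (⊖≤⇔ (n * m) (a * m)) h))))))
    where toℚᵘ-a = ℚₚ.toℚᵘ-fromℚᵘ (mkℚᵘ (ℤ.+ a) 0)

  mirroredBound-nonNegative : ∀ k → j < n * m → ¬ bound ℚ.≤ (-[1+ k ] ℚ./ 1)
  mirroredBound-nonNegative k j<nm h
    with ℚᵘₚ.≤-respʳ-≃ (ℚₚ.toℚᵘ-fromℚᵘ (mkℚᵘ -[1+ k ] 0)) (ℚᵘₚ.≤-respˡ-≃ toℚᵘ-bound (ℚₚ.toℚᵘ-mono-≤ h))
  ... | ℚᵘ.*≤* h′ with subst (ℤ._≤ _) (trans numerator (ℤₚ.⊖-≥ (<⇒≤ j<nm))) h′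
  ... | ()

module _ (m : ℕ) .{{_ : NonZero m}} where
  head-map-* : ∀ w → head₀ (map (m *_) w) ≡ m * head₀ w
  head-map-* [] = sym (*-zeroʳ m)
  head-map-* (_ ∷ _) = refl

  nth-map-* : ∀ w i → nth (map (m *_) w) i ≡ m * nth w i
  nth-map-* [] i = sym (*-zeroʳ m)
  nth-map-* (_ ∷ _) zero = refl
  nth-map-* (_ ∷ w) (suc i) = nth-map-* w i

  map-*-descending : ∀ w → Descending w → Descending (map (m *_) w)
  map-*-descending [] _ = tt
  map-*-descending (x ∷ w) (h , w↓) =
    subst (_≤ m * x) (sym (head-map-* w)) (*-monoʳ-≤ m h) , map-*-descending w w↓

  map-*-descending⁻¹ : ∀ w → Descending (map (m *_) w) → Descending w
  map-*-descending⁻¹ [] _ = tt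
  map-*-descending⁻¹ (x ∷ w) (h , w↓) =
    *-cancelˡ-≤ m (subst (_≤ m * x) (head-map-* w) h) , map-*-descending⁻¹ w w↓

  map-*-≼ : ∀ {a b} → a ≼ b → map (m *_) a ≼ map (m *_) b
  map-*-≼ {[]} {[]} _ = tt
  map-*-≼ {x ∷ a} {y ∷ b} (x≤y , d , a≼b) =
    *-monoʳ-≤ m x≤y ,
    (λ h → subst (_< m * x) (sym (head-map-* a))
             (*-monoʳ-< m (d (*-cancelˡ-< m _ _ (subst (_< m * y) (head-map-* b) h))))) ,
    map-*-≼ a≼b

  map-*-≼⁻¹ : ∀ {a b} → map (m *_) a ≼ map (m *_) b → a ≼ b
  map-*-≼⁻¹ {[]} {[]} _ = tt
  map-*-≼⁻¹ {x ∷ a} {y ∷ b} (x≤y , d , a≼b) =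
    *-cancelˡ-≤ m x≤y ,
    (λ h → *-cancelˡ-< m _ _ (subst (_< m * x) (head-map-* a)
             (d (subst (_< m * y) (sym (head-map-* b)) (*-monoʳ-< m h))))) ,
    map-*-≼⁻¹ a≼b

  map-*-positive⁻¹ : ∀ w → Positive (map (m *_) w) → Positive w
  map-*-positive⁻¹ w h =
    All.map (λ {x} 0<mx → *-cancelˡ-< m 0 x (subst (_< m * x) (sym (*-zeroʳ m)) 0<mx)) (Allₚ.map⁻ h)

  map-/-map-* : ∀ l → All (m ∣_) l → map (m *_) (map (_/ m) l) ≡ l
  map-/-map-* [] _ = refl
  map-/-map-* (x ∷ l) (m∣x ∷ m∣l) = cong₂ _∷_ (m*[n/m]≡n m∣x) (map-/-map-* l m∣l)

  all-∣-map-* : ∀ w → All (m ∣_) (map (m *_) w)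
  all-∣-map-* [] = []
  all-∣-map-* (x ∷ w) = m∣m*n x ∷ all-∣-map-* w

record MirroredCode (m n : ℕ) (w : List ℕ) : Set where
  field
    descending : Descending w
    length≡    : length w ≡ m * n
    staircase  : Staircase 1 (map (m *_) w)
    head≤      : head₀ w ≤ n

inSeqs'⇒mirroredCode : ∀ m′ n {u} → InSeqs' (suc m′) n u → ∃ λ w → u ≈ w × MirroredCode (suc m′) n w
inSeqs'⇒mirroredCode m′ n {u} (u↓ , bounds) = w , u≈w , record
  { descending = ≈-descending u≈w u↓
  ; length≡    = ≈-length u≈w
  ; staircase  = nth-staircase 1 (map (m *_) w) above
  ; head≤      = ≈-head≤ n u≈w (proj₂ ∘ bounds)
  }
  where
  m = suc m′
  nonNegative : ∀ j → 0ℤ ℤ.≤ lookup u j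
  nonNegative j with lookup u j | proj₁ (bounds j)
  ... | ℤ.+ _ | _ = ℤ.+≤+ z≤n
  ... | -[1+ k ] | h =
    ⊥-elim (mirroredBound-nonNegative m′ n (toℕ j) k (subst (toℕ j <_) (*-comm m n) (toℕ<n j)) h)
  w = proj₁ (≈-nonNegative u nonNegative)
  u≈w = proj₂ (≈-nonNegative u nonNegative)
  above : ∀ i → i < length (map (m *_) w) → 1 * (length (map (m *_) w) ∸ i) ≤ nth (map (m *_) w) i
  above i i<len = begin
    1 * (length (map (m *_) w) ∸ i) ≡⟨ *-identityˡ _ ⟩
    length (map (m *_) w) ∸ i       ≡⟨ cong (_∸ i) (trans (length-map (m *_) w) (≈-length u≈w)) ⟩
    m * n ∸ i                       ≤⟨ m≤n+o⇒m∸n≤o (m * n) i 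
                                         (subst₂ _≤_ (*-comm n m) (trans (cong (_+ i) (*-comm (nth w i) m))
                                           (+-comm (m * nth w i) i)) scaled-bound) ⟩
    m * nth w i                     ≡⟨ nth-map-* m w i ⟨
    nth (map (m *_) w) i            ∎
    where
    open ≤-Reasoning
    i<mn = subst (i <_) (trans (length-map (m *_) w) (≈-length u≈w)) i<len
    scaled-bound : n * m ≤ nth w i * m + i
    scaled-bound = Equivalence.to (mirroredBound⇔ m′ n i (nth w i))
      (subst (λ k → mirroredBound m′ n i ℚ.≤ (k ℚ./ 1)) (≈-lookup-fromℕ< u≈w i i<mn)
        (subst (λ k → mirroredBound m′ n k ℚ.≤ (lookup u (fromℕ< i<mn) ℚ./ 1))
          (toℕ-fromℕ< i<mn) (proj₁ (bounds (fromℕ< i<mn)))))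

mirroredCode⇒inSeqs' : ∀ m′ n {u w} → u ≈ w → MirroredCode (suc m′) n w → InSeqs' (suc m′) n u
mirroredCode⇒inSeqs' m′ n {u} {w} u≈w cw =
  ≈-nonincreasing u≈w descending , λ j → lower j , ≈-≤ n u≈w descending head≤ j
  where
  open MirroredCode cw
  m = suc m′
  length-scaled : length (map (m *_) w) ≡ m * n
  length-scaled = trans (length-map (m *_) w) length≡
  lower : ∀ j → mirroredBound m′ n (toℕ j) ℚ.≤ (lookup u j ℚ./ 1)
  lower j = subst (λ k → mirroredBound m′ n (toℕ j) ℚ.≤ (k ℚ./ 1)) (sym (≈-lookup u≈w j))
    (Equivalence.from (mirroredBound⇔ m′ n (toℕ j) (nth w (toℕ j))) (begin
      n * m                             ≡⟨ *-comm n m ⟩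
      m * n                             ≤⟨ m≤n+m∸n (m * n) (toℕ j) ⟩
      toℕ j + (m * n ∸ toℕ j)           ≤⟨ +-monoʳ-≤ (toℕ j) staircase-j ⟩
      toℕ j + m * nth w (toℕ j)         ≡⟨ +-comm (toℕ j) _ ⟩
      m * nth w (toℕ j) + toℕ j         ≡⟨ cong (_+ toℕ j) (*-comm m _) ⟩
      nth w (toℕ j) * m + toℕ j         ∎))
    where
    open ≤-Reasoning
    j<length = subst (toℕ j <_) (sym length-scaled) (toℕ<n j)
    staircase-j : m * n ∸ toℕ j ≤ m * nth w (toℕ j)
    staircase-j = subst₂ (λ a b → a ∸ toℕ j ≤ b) length-scaled (nth-map-* m w (toℕ j))
      (subst (_≤ nth (map (m *_) w) (toℕ j)) (*-identityˡ _)
        (staircase-nth 1 (map (m *_) w) staircase (toℕ j) j<length))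

ψ-≈ : ∀ m′ n p w → All (suc m′ ∣_) (proj₂ (descents₀ p)) → downCounts p ≡ map (suc m′ *_) w →
  length w ≡ suc m′ * n → ψ (suc m′) n p ≈ w
ψ-≈ m′ n p w m∣ds e length≡ = ≈-intro (ψ m n p) w length≡ λ j → trans (lookup∘tabulate _ j) (cong ℤ.+_ (begin
  blocks m (afterUp (suc (toℕ j)) p)
    ≡⟨ blocks≡countD/ m (afterUp (suc (toℕ j)) p) (afterUp-descentsDivisible m (toℕ j) p m∣ds) ⟩
  countD (afterUp (suc (toℕ j)) p) / m      ≡⟨ cong (_/ m) (nth-downCounts p (toℕ j)) ⟨
  nth (downCounts p) (toℕ j) / m            ≡⟨ cong (λ l → nth l (toℕ j) / m) e ⟩
  nth (map (m *_) w) (toℕ j) / m            ≡⟨ cong (_/ m) (nth-map-* m w (toℕ j)) ⟩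
  m * nth w (toℕ j) / m                     ≡⟨ cong (_/ m) (*-comm m (nth w (toℕ j))) ⟩
  nth w (toℕ j) * m / m                     ≡⟨ m*n/n≡m (nth w (toℕ j)) m ⟩
  nth w (toℕ j)                             ∎))
  where
  m = suc m′
  open ≡-Reasoning

mirrored⇒descentsDivisible : ∀ m n .{{_ : NonZero m}} {p} → IsMirroredMDyck m n p → DescentsDivisible m p
mirrored⇒descentsDivisible m n {p} (_ , m∣ds) =
  all-dropZeros⁻ (m ∣0) _ (subst (All (m ∣_)) (descentLengths≡dropZeros p) m∣ds)

module _ (m′ n : ℕ) where
  private m = suc m′

  mirrored⇒mirroredCode : ∀ {p} → IsMirroredMDyck m n p →
    ∃ λ w → MirroredCode m n w × downCounts p ≡ map (m *_) w
  mirrored⇒mirroredCode {p} sp@(dp , _) = w , record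
    { descending = map-*-descending⁻¹ m w (subst Descending e descending)
    ; length≡    = trans (length-map (_/ m) (downCounts p)) length≡
    ; staircase  = subst (Staircase 1) e staircase
    ; head≤      = *-cancelˡ-≤ m (subst (_≤ m * n) (trans (cong head₀ e) (head-map-* m w)) head≤)
    } , e
    where
    open DyckCode (dyck⇒dyckCode (m * n) p dp)
    w = map (_/ m) (downCounts p)
    e : downCounts p ≡ map (m *_) w
    e = sym (map-/-map-* m _ (downCounts-divisible m p (All.tail (mirrored⇒descentsDivisible m n sp))))

  mirroredCode⇒dyckCode : ∀ {w} → MirroredCode m n w → DyckCode (m * n) (map (m *_) w)
  mirroredCode⇒dyckCode {w} cw = record
    { descending = map-*-descending m w descending
    ; staircase  = staircase
    ; length≡    = trans (length-map (m *_) w) length≡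
    ; head≤      = subst (_≤ m * n) (sym (head-map-* m w)) (*-monoʳ-≤ m head≤)
    }
    where open MirroredCode cw

  mirroredCode⇒mirrored : ∀ {w} → MirroredCode m n w →
    IsMirroredMDyck m n (fromDownCounts (m * n) (map (m *_) w))
  mirroredCode⇒mirrored {w} cw = dyckCode⇒dyck (m * n) (map (m *_) w) (mirroredCode⇒dyckCode cw) ,
    subst (All (m ∣_)) (sym (descentLengths≡dropZeros p)) (all-dropZeros⁺ _
      (fromDownCounts-descentsDivisible m (m * n) (map (m *_) w) (m∣m*n n) (all-∣-map-* m w) descending head≤))
    where
    p = fromDownCounts (m * n) (map (m *_) w)
    open DyckCode (mirroredCode⇒dyckCode cw)

  mirroredCoding : Coding (m * n) (m * n) (IsMirroredMDyck m n) (ψ m n) (InSeqs' m n)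
  mirroredCoding = record
    { Code            = MirroredCode m n
    ; code-descending = MirroredCode.descending
    ; code-positive   = λ {w} cw → map-*-positive⁻¹ m w (staircase⇒positive 1 (MirroredCode.staircase cw))
    ; code-length     = MirroredCode.length≡
    ; embed           = map (m *_)
    ; embed-≼         = map-*-≼ m
    ; embed-≼⁻¹       = map-*-≼⁻¹ m
    ; isDyck          = proj₁
    ; code            = mirrored⇒mirroredCode
    ; ≈-code          = λ {p} {w} sp cw e →
        ψ-≈ m′ n p w (All.tail (mirrored⇒descentsDivisible m n sp)) e (MirroredCode.length≡ cw)
    ; decode-dyckCode = mirroredCode⇒dyckCode
    ; decode          = mirroredCode⇒mirrored
    ; T⇒code          = inSeqs'⇒mirroredCode m′ n
    ; code⇒T          = mirroredCode⇒inSeqs' m′ n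
    }

∨-mirroredCode : ∀ m .{{_ : NonZero m}} n {a b} → MirroredCode m n a → MirroredCode m n b →
  MirroredCode m n (a ∨ b)
∨-mirroredCode m n {a} {b} ca cb = record
  { descending = descending
  ; length≡    = trans (sym (≼-length upperˡ)) A.length≡
  ; staircase  = ≼-staircase 1 (map-*-≼ m upperˡ) A.staircase
  ; head≤      = ≤-trans (∨-head a b) (⊔-lub A.head≤ B.head≤)
  }
  where
  module A = MirroredCode ca
  module B = MirroredCode cb
  open IsJoinOf (∨-isJoin a b A.descending B.descending
                  (map-*-positive⁻¹ m a (staircase⇒positive 1 A.staircase))
                  (map-*-positive⁻¹ m b (staircase⇒positive 1 B.staircase))
                  (trans A.length≡ (sym B.length≡)))

mirrored-isJoinSemilattice×isIsoOnto : ∀ m′ n → let m = suc m′ in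
  IsJoinSemilattice (IsMirroredMDyck m n) (λ p q → p ≤𝔻[ m * n ] q) ×
  IsIsoOnto (IsMirroredMDyck m n) (λ p q → p ≤𝔻[ m * n ] q) (InSeqs' m n) _⊴_ (ψ m n)
mirrored-isJoinSemilattice×isIsoOnto m′ n = joinSemilattice (∨-mirroredCode (suc m′) n) , isIsoOnto
  where open Coded (mirroredCoding m′ n)

proposition2p7 : (m n : ℕ) → {{_ : NonZero m}} → 1 ≤ n →
    (IsLattice (IsMDyck m n) (λ p q → p ≤𝔻[ m * n ] q) ×
     IsIsoOnto (IsMDyck m n) (λ p q → p ≤𝔻[ m * n ] q) (InSeqs m n) _⊴_ (φ m n)) ×
    (IsJoinSemilattice (IsMirroredMDyck m n) (λ p q → p ≤𝔻[ m * n ] q) ×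
     IsIsoOnto (IsMirroredMDyck m n) (λ p q → p ≤𝔻[ m * n ] q) (InSeqs' m n) _⊴_ (ψ m n))
proposition2p7 (suc m′) n _ = mDyck-isLattice×isIsoOnto m′ n , mirrored-isJoinSemilattice×isIsoOnto m′ n
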